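{- Let $G$ be a graph with $n$ vertices, $m$ edges and $k(G)$ connected components, containing at least one cycle, and let $i$ be a nonnegative integer. Then $g(G)>n-k(G)-i$ if and only if \[ [x^i]\,T_G(x,1)=\binom{m-i-1}{n-k(G)-i}. \]
   Context: $T_G(x,y)$ is the Tutte polynomial of $G$, i.e. $T_G(x,y)=\sum_{A\subseteq E}(x-1)^{rk(E)-rk(A)}(y-1)^{|A|-rk(A)}$ with $rk(A)=|V|-k(A)$, where $k(A)$ is the number of components of the spanning subgraph $(V,A)$; $[x^i]f(x)$ denotes the coefficient of $x^i$. $g(G)$ is the girth of $G$, the length of a shortest cycle. -}

module Defs where

open import Data.Nat using (ℕ; zero; suc; _∸_; _<_; _≤_; _≟_)
open import Data.Integer as ℤ using (ℤ; +_; -[1+_])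
open import Data.Fin using (Fin; toℕ)
open import Data.Fin.Properties using () renaming (_≟_ to _≟ᶠ_)
open import Data.List using (List; []; _∷_; _++_; [_]; length; map; filter; foldr; replicate)
open import Data.List.Relation.Unary.All using (All)
open import Data.List.Relation.Unary.Unique.Propositional using (Unique)
open import Data.List.Relation.Unary.Linked using (Linked)
open import Data.List.Membership.Propositional using (_∈_)
open import Data.Product using (Σ; _×_; _,_; proj₁; proj₂)
open import Data.Sum using (_⊎_)
open import Relation.Binary.PropositionalEquality using (_≡_)
open import Relation.Nullary using (yes; no; does)
open import Data.Bool using (Bool; if_then_else_)

-- Finite simple graphs on vertex set Fin n.
-- Edges are pairs (u , v) with u < v (no loops), listed without repetition
-- (no multiple edges).

Edge : ℕ → Set
Edge n = Fin n × Fin n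

record Graph (n : ℕ) : Set where
  field
    edges    : List (Edge n)
    ordered  : All (λ e → toℕ (proj₁ e) < toℕ (proj₂ e)) edges
    distinct : Unique edges
open Graph public

#edges : ∀ {n} → Graph n → ℕ
#edges G = length (edges G)

-- Computed by label merging: every vertex v starts with label v; for each
-- edge (u , w) of A all vertices carrying w's label are relabelled with u's
-- label.  Afterwards two vertices carry the same label iff they are connected
-- in (Fin n , A), and every class is labelled by one of its own vertices,
-- which is the unique vertex of the class whose label is itself.  Hence
-- k(A) = number of vertices v with label v ≡ v.

Labelling : ℕ → Set
Labelling n = Fin n → Fin n

merge : ∀ {n} → Labelling n → Edge n → Labelling n
merge lab (u , w) v with lab v ≟ᶠ lab w
... | yes _ = lab u
... | no  _ = lab v

labels : ∀ {n} → List (Edge n) → Labelling n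
labels = foldr (λ e lab → merge lab e) (λ v → v)

count : ∀ {n} → (Fin n → Bool) → ℕ
count {zero}  p = 0
count {suc n} p = (if p Fin.zero then 1 else 0) Data.Nat.+ count {n} (λ v → p (Fin.suc v))
  where import Data.Fin as Fin; import Data.Nat

components : ∀ {n} → List (Edge n) → ℕ
components {n} A = count (λ v → does (labels A v ≟ᶠ v))

rk : ∀ {n} → List (Edge n) → ℕ
rk {n} A = n ∸ components A

k : ∀ {n} → Graph n → ℕ
k G = components (edges G)

-- Polynomials with integer coefficients, as coefficient lists
-- (constant term first).

Poly : Set
Poly = List ℤ

_⊕_ : Poly → Poly → Poly
[]       ⊕ q        = q
p        ⊕ []       = p
(a ∷ p)  ⊕ (b ∷ q)  = (a ℤ.+ b) ∷ (p ⊕ q)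

scale : ℤ → Poly → Poly
scale c = map (c ℤ.*_)

_⊗_ : Poly → Poly → Poly
[]      ⊗ q = []
(a ∷ p) ⊗ q = scale a q ⊕ (ℤ.0ℤ ∷ (p ⊗ q))

pow : Poly → ℕ → Poly
pow p zero    = ℤ.1ℤ ∷ []
pow p (suc e) = p ⊗ pow p e

X-1 : Poly
X-1 = -[1+ 0 ] ∷ ℤ.1ℤ ∷ []

coeff : ℕ → Poly → ℤ
coeff i       []      = ℤ.0ℤ
coeff zero    (a ∷ p) = a
coeff (suc i) (a ∷ p) = coeff i p

-- Bivariate polynomials in x, y: list of coefficients of y^0, y^1, ...,
-- each coefficient a polynomial in x.
Poly2 : Set
Poly2 = List Poly

_⊕₂_ : Poly2 → Poly2 → Poly2
[]       ⊕₂ q        = q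
p        ⊕₂ []       = p
(a ∷ p)  ⊕₂ (b ∷ q)  = (a ⊕ b) ∷ (p ⊕₂ q)

xy : Poly → Poly → Poly2
xy px py = map (λ c → scale c px) py

atY1 : Poly2 → Poly
atY1 = foldr _⊕_ []

subsets : ∀ {a} {X : Set a} → List X → List (List X)
subsets []       = [] ∷ []
subsets (e ∷ es) = let s = subsets es in s ++ map (e ∷_) s

tutte : ∀ {n} → Graph n → Poly2
tutte G = foldr _⊕₂_ []
  (map (λ A → xy (pow X-1 (rk (edges G) ∸ rk A)) (pow X-1 (length A ∸ rk A)))
       (subsets (edges G)))

Adj : ∀ {n} → Graph n → Fin n → Fin n → Set
Adj G u v = ((u , v) ∈ edges G) ⊎ ((v , u) ∈ edges G)

-- A cycle is a list v₀ … v_{l-1} of l ≥ 3 distinct vertices with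
-- v_j adjacent to v_{j+1} and v_{l-1} adjacent to v₀.  Its length is l.
IsCycle : ∀ {n} → Graph n → List (Fin n) → Set
IsCycle G []       = Data.Empty.⊥ where import Data.Empty
IsCycle G (v ∷ vs) =
  (3 ≤ length (v ∷ vs)) × Unique (v ∷ vs) × Linked (Adj G) ((v ∷ vs) ++ [ v ])

HasCycle : ∀ {n} → Graph n → Set
HasCycle G = Σ _ (IsCycle G)

IsGirth : ∀ {n} → Graph n → ℕ → Set
IsGirth G g =
  Σ _ (λ c → IsCycle G c × length c ≡ g) ×
  (∀ c → IsCycle G c → g ≤ length c)

-- Binomial coefficient with possibly negative lower index:
-- binom a b = C(a, b) if b ≥ 0, and 0 if b < 0.
binomℤ : ℕ → ℤ → ℤ
binomℤ a (+ b)     = + (a C b) where open import Data.Nat.Combinatorics using (_C_)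
binomℤ a -[1+ _ ]  = ℤ.0ℤ

{-# OPTIONS --safe #-}
-- Summing over A ⊆ E, T_G(x,1) = Σ_{A forest} (x-1)^{r-|A|} with r = n - k(G), so [x^i] T_G(x,1)
-- only sees forests of at most r - i edges.  For any matroid of rank r and corank d this
-- coefficient is at most C(d+k-1, k), k = r - i, with equality exactly when every set of at
-- most k elements is independent: induct on the ground set, splitting off its first element e
-- by deletion and contraction (Pascal's rule) when e is neither a loop nor a coloop; a loop only
-- raises the corank, and for a coloop the terms of B and B ∪ {e} combine to x (x-1)^{r-1-|B|}.
-- In the cycle matroid of G a dependent set of at most k edges contains a cycle of length at
-- most k, and a cycle is itself a dependent set, so equality holds iff g(G) > k.  For i > r
-- both sides of the equivalence hold trivially.
module Submission where

open import Defs
open import Data.Nat using (ℕ)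

module Polynomials where

  open import Data.Nat using (ℕ; zero; suc; s≤s)
  import Data.Nat as ℕ
  open import Data.Nat.Properties using (m<n⇒m<1+n)
  open import Data.Integer using (ℤ; 0ℤ; 1ℤ; -[1+_]; _+_; _*_; -_; _-_)
  open import Data.Integer.Properties
  open import Data.List using (List; []; _∷_; map; foldr)
  open import Relation.Binary.PropositionalEquality
  open import Algebra.Properties.CommutativeSemigroup +-commutativeSemigroup using (interchange)

  sumℤ : List ℤ → ℤ
  sumℤ = foldr _+_ 0ℤ

  coeff-⊕ : ∀ i p q → coeff i (p ⊕ q) ≡ coeff i p + coeff i q
  coeff-⊕ i       []      q       = sym (+-identityˡ _)
  coeff-⊕ i       (a ∷ p) []      = sym (+-identityʳ _)
  coeff-⊕ zero    (a ∷ p) (b ∷ q) = refl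
  coeff-⊕ (suc i) (a ∷ p) (b ∷ q) = coeff-⊕ i p q

  coeff-scale : ∀ i c p → coeff i (scale c p) ≡ c * coeff i p
  coeff-scale i       c []      = sym (*-zeroʳ c)
  coeff-scale zero    c (a ∷ p) = refl
  coeff-scale (suc i) c (a ∷ p) = coeff-scale i c p

  -- On a coefficient list, sumℤ is evaluation at 1.
  sum-⊕ : ∀ p q → sumℤ (p ⊕ q) ≡ sumℤ p + sumℤ q
  sum-⊕ []      q       = sym (+-identityˡ _)
  sum-⊕ (a ∷ p) []      = sym (+-identityʳ _)
  sum-⊕ (a ∷ p) (b ∷ q) = trans (cong ((a + b) +_) (sum-⊕ p q)) (interchange a b (sumℤ p) (sumℤ q))

  sum-scale : ∀ c p → sumℤ (scale c p) ≡ c * sumℤ p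
  sum-scale c []      = sym (*-zeroʳ c)
  sum-scale c (a ∷ p) = trans (cong (c * a +_) (sum-scale c p)) (sym (*-distribˡ-+ c a (sumℤ p)))

  sum-⊗ : ∀ p q → sumℤ (p ⊗ q) ≡ sumℤ p * sumℤ q
  sum-⊗ []      q = refl
  sum-⊗ (a ∷ p) q = begin
    sumℤ (scale a q ⊕ (0ℤ ∷ p ⊗ q))     ≡⟨ sum-⊕ (scale a q) (0ℤ ∷ p ⊗ q) ⟩
    sumℤ (scale a q) + (0ℤ + sumℤ (p ⊗ q)) ≡⟨ cong (sumℤ (scale a q) +_) (+-identityˡ _) ⟩
    sumℤ (scale a q) + sumℤ (p ⊗ q)     ≡⟨ cong₂ _+_ (sum-scale a q) (sum-⊗ p q) ⟩
    a * sumℤ q + sumℤ p * sumℤ q        ≡⟨ sym (*-distribʳ-+ (sumℤ q) a (sumℤ p)) ⟩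
    (a + sumℤ p) * sumℤ q               ∎
    where open ≡-Reasoning

  sum-pow-X-1 : ∀ e → sumℤ (pow X-1 (suc e)) ≡ 0ℤ
  sum-pow-X-1 e = sum-⊗ X-1 (pow X-1 e)

  coeff-X-1⊗-zero : ∀ p → coeff 0 (X-1 ⊗ p) ≡ - coeff 0 p
  coeff-X-1⊗-zero []      = refl
  coeff-X-1⊗-zero (b ∷ p) = trans (+-identityʳ _) (-1*i≡-i b)

  coeff-1⊗ : ∀ i p → coeff i ((1ℤ ∷ []) ⊗ p) ≡ coeff i p
  coeff-1⊗ i p = begin
    coeff i (scale 1ℤ p ⊕ (0ℤ ∷ []))          ≡⟨ coeff-⊕ i (scale 1ℤ p) (0ℤ ∷ []) ⟩
    coeff i (scale 1ℤ p) + coeff i (0ℤ ∷ [])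
      ≡⟨ cong₂ _+_ (trans (coeff-scale i 1ℤ p) (*-identityˡ _)) (coeff-0 i) ⟩
    coeff i p + 0ℤ                            ≡⟨ +-identityʳ _ ⟩
    coeff i p                                 ∎
    where
    open ≡-Reasoning
    coeff-0 : ∀ i → coeff i (0ℤ ∷ []) ≡ 0ℤ
    coeff-0 zero    = refl
    coeff-0 (suc i) = refl

  coeff-X-1⊗-suc : ∀ i p → coeff (suc i) (X-1 ⊗ p) ≡ coeff i p - coeff (suc i) p
  coeff-X-1⊗-suc i p = begin
    coeff (suc i) (scale -[1+ 0 ] p ⊕ (0ℤ ∷ (1ℤ ∷ []) ⊗ p))
      ≡⟨ coeff-⊕ (suc i) (scale -[1+ 0 ] p) (0ℤ ∷ (1ℤ ∷ []) ⊗ p) ⟩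
    coeff (suc i) (scale -[1+ 0 ] p) + coeff i ((1ℤ ∷ []) ⊗ p)
      ≡⟨ cong₂ _+_ (trans (coeff-scale (suc i) -[1+ 0 ] p) (-1*i≡-i _)) (coeff-1⊗ i p) ⟩
    - coeff (suc i) p + coeff i p
      ≡⟨ +-comm (- coeff (suc i) p) (coeff i p) ⟩
    coeff i p - coeff (suc i) p ∎
    where open ≡-Reasoning

  coeff-pow-X-1-> : ∀ {i e} → e ℕ.< i → coeff i (pow X-1 e) ≡ 0ℤ
  coeff-pow-X-1-> {suc i}       {zero}  _         = refl
  coeff-pow-X-1-> {suc zero}    {suc e} (s≤s ())
  coeff-pow-X-1-> {suc (suc i)} {suc e} (s≤s e<i) = begin
    coeff (suc (suc i)) (X-1 ⊗ pow X-1 e)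
      ≡⟨ coeff-X-1⊗-suc (suc i) (pow X-1 e) ⟩
    coeff (suc i) (pow X-1 e) - coeff (suc (suc i)) (pow X-1 e)
      ≡⟨ cong₂ _-_ (coeff-pow-X-1-> e<i) (coeff-pow-X-1-> (m<n⇒m<1+n e<i)) ⟩
    0ℤ ∎
    where open ≡-Reasoning

  coeff-atY1-⊕₂ : ∀ i p q → coeff i (atY1 (p ⊕₂ q)) ≡ coeff i (atY1 p) + coeff i (atY1 q)
  coeff-atY1-⊕₂ i []      q       = sym (+-identityˡ _)
  coeff-atY1-⊕₂ i (a ∷ p) []      = sym (+-identityʳ _)
  coeff-atY1-⊕₂ i (a ∷ p) (b ∷ q) = begin
    coeff i ((a ⊕ b) ⊕ atY1 (p ⊕₂ q))
      ≡⟨ coeff-⊕ i (a ⊕ b) (atY1 (p ⊕₂ q)) ⟩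
    coeff i (a ⊕ b) + coeff i (atY1 (p ⊕₂ q))
      ≡⟨ cong₂ _+_ (coeff-⊕ i a b) (coeff-atY1-⊕₂ i p q) ⟩
    (coeff i a + coeff i b) + (coeff i (atY1 p) + coeff i (atY1 q))
      ≡⟨ interchange (coeff i a) (coeff i b) (coeff i (atY1 p)) (coeff i (atY1 q)) ⟩
    (coeff i a + coeff i (atY1 p)) + (coeff i b + coeff i (atY1 q))
      ≡⟨ sym (cong₂ _+_ (coeff-⊕ i a (atY1 p)) (coeff-⊕ i b (atY1 q))) ⟩
    coeff i (a ⊕ atY1 p) + coeff i (b ⊕ atY1 q) ∎
    where open ≡-Reasoning

  coeff-atY1-xy : ∀ i px py → coeff i (atY1 (xy px py)) ≡ coeff i px * sumℤ py
  coeff-atY1-xy i px []       = sym (*-zeroʳ (coeff i px))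
  coeff-atY1-xy i px (c ∷ py) = begin
    coeff i (scale c px ⊕ atY1 (xy px py))
      ≡⟨ coeff-⊕ i (scale c px) (atY1 (xy px py)) ⟩
    coeff i (scale c px) + coeff i (atY1 (xy px py))
      ≡⟨ cong₂ _+_ (trans (coeff-scale i c px) (*-comm c (coeff i px))) (coeff-atY1-xy i px py) ⟩
    coeff i px * c + coeff i px * sumℤ py
      ≡⟨ sym (*-distribˡ-+ (coeff i px) c (sumℤ py)) ⟩
    coeff i px * (c + sumℤ py) ∎
    where open ≡-Reasoning

  coeff-atY1-sum : ∀ {A : Set} i (f : A → Poly2) (L : List A) →
    coeff i (atY1 (foldr _⊕₂_ [] (map f L))) ≡ sumℤ (map (λ a → coeff i (atY1 (f a))) L)
  coeff-atY1-sum i f []      = refl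
  coeff-atY1-sum i f (a ∷ L) =
    trans (coeff-atY1-⊕₂ i (f a) (foldr _⊕₂_ [] (map f L)))
          (cong (coeff i (atY1 (f a)) +_) (coeff-atY1-sum i f L))

module Subsets {X : Set} where

  open import Data.Integer using (ℤ; 0ℤ; _+_)
  open import Data.Integer.Properties using (+-identityˡ; +-assoc; +-commutativeSemigroup)
  open import Data.List using (List; []; _∷_; map; _++_)
  open import Data.List.Properties using (map-∘)
  import Data.List.Relation.Unary.All as All
  open All using (All; []; _∷_)
  open import Data.List.Relation.Unary.All.Properties using (++⁺; map⁺)
  open import Data.List.Relation.Binary.Sublist.Propositional using (_⊆_; []; _∷_; _∷ʳ_)
  open import Data.Product using (∃-syntax; _×_; _,_)
  open import Relation.Nullary using (Dec; yes; no)
  open import Relation.Unary using (Decidable)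
  open import Relation.Binary.PropositionalEquality
  open import Algebra.Properties.CommutativeSemigroup +-commutativeSemigroup using (interchange)
  open Polynomials using (sumℤ)

  subsets-⊆ : ∀ (E : List X) → All (_⊆ E) (subsets E)
  subsets-⊆ []      = [] ∷ []
  subsets-⊆ (e ∷ E) = ++⁺ (All.map (e ∷ʳ_) (subsets-⊆ E)) (map⁺ (All.map (refl ∷_) (subsets-⊆ E)))

  sum-map-++ : ∀ (f : List X → ℤ) L L' → sumℤ (map f (L ++ L')) ≡ sumℤ (map f L) + sumℤ (map f L')
  sum-map-++ f []      L' = sym (+-identityˡ _)
  sum-map-++ f (A ∷ L) L' = trans (cong (f A +_) (sum-map-++ f L L')) (sym (+-assoc (f A) _ _))

  sum-subsets-∷ : ∀ (f : List X → ℤ) e E →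
    sumℤ (map f (subsets (e ∷ E))) ≡ sumℤ (map f (subsets E)) + sumℤ (map (λ B → f (e ∷ B)) (subsets E))
  sum-subsets-∷ f e E = trans (sum-map-++ f (subsets E) (map (e ∷_) (subsets E)))
                              (cong (sumℤ (map f (subsets E)) +_) (cong sumℤ (sym (map-∘ (subsets E)))))

  sum-cong-All : ∀ {P : List X → Set} {f g : List X → ℤ} {L} → All P L → (∀ {A} → P A → f A ≡ g A) →
    sumℤ (map f L) ≡ sumℤ (map g L)
  sum-cong-All []         f≡g = refl
  sum-cong-All (pA ∷ pL) f≡g = cong₂ _+_ (f≡g pA) (sum-cong-All pL f≡g)

  sum-zero-All : ∀ {P : List X → Set} {f : List X → ℤ} {L} → All P L → (∀ {A} → P A → f A ≡ 0ℤ) →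
    sumℤ (map f L) ≡ 0ℤ
  sum-zero-All []         f≡0 = refl
  sum-zero-All (pA ∷ pL) f≡0 = cong₂ _+_ (f≡0 pA) (sum-zero-All pL f≡0)

  sum-map-+ : ∀ (f g : List X → ℤ) L → sumℤ (map (λ A → f A + g A) L) ≡ sumℤ (map f L) + sumℤ (map g L)
  sum-map-+ f g []      = refl
  sum-map-+ f g (A ∷ L) =
    trans (cong (f A + g A +_) (sum-map-+ f g L)) (interchange (f A) (g A) (sumℤ (map f L)) (sumℤ (map g L)))

  ∃-⊆? : ∀ {P : List X → Set} → Decidable P → ∀ E → Dec (∃[ A ] A ⊆ E × P A)
  ∃-⊆? P? [] with P? []
  ... | yes p  = yes ([] , [] , p)
  ... | no ¬p  = no λ { ([] , [] , p) → ¬p p }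
  ∃-⊆? P? (e ∷ E) with ∃-⊆? P? E | ∃-⊆? (λ B → P? (e ∷ B)) E
  ... | yes (A , A⊆E , p) | _                  = yes (A , e ∷ʳ A⊆E , p)
  ... | no _              | yes (B , B⊆E , p)  = yes (e ∷ B , refl ∷ B⊆E , p)
  ... | no ¬skip          | no ¬keep           = no λ
    { (A , _ ∷ʳ A⊆E , p)        → ¬skip (A , A⊆E , p)
    ; (_ ∷ B , refl ∷ B⊆E , p) → ¬keep (B , B⊆E , p) }

module UniformCoefficients where

  open import Data.Nat using (ℕ; zero; suc; _+_; _∸_; _≤_; _<_; z≤n)
  open import Data.Nat.Properties
    using (≤-refl; ≤-trans; m≤m+n; m≤n+m; m<m+n; +-comm; +-suc; +-assoc; +-∸-assoc; m+n∸n≡m; m∸n+n≡m; ∸-+-assoc)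
  open import Data.Nat.Combinatorics using (_C_; nCn≡1; nCk+nC[k+1]≡[n+1]C[k+1])
  open import Relation.Binary.PropositionalEquality hiding ([_])

  -- The bound for corank d and k = rank - i; its recursion mirrors deletion–contraction.
  uniformCoeff : ℕ → ℕ → ℕ
  uniformCoeff d       zero    = 1
  uniformCoeff zero    (suc k) = 0
  uniformCoeff (suc d) (suc k) = uniformCoeff d (suc k) + uniformCoeff (suc d) k

  uniformCoeff-pos : ∀ d k → 1 ≤ uniformCoeff (suc d) k
  uniformCoeff-pos d zero    = ≤-refl
  uniformCoeff-pos d (suc k) = ≤-trans (uniformCoeff-pos d k) (m≤n+m _ _)

  uniformCoeff-mono : ∀ d k → uniformCoeff d k ≤ uniformCoeff (suc d) k
  uniformCoeff-mono d       zero    = ≤-refl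
  uniformCoeff-mono zero    (suc k) = z≤n
  uniformCoeff-mono (suc d) (suc k) = m≤m+n _ _

  uniformCoeff-strict : ∀ d k → uniformCoeff d (suc k) < uniformCoeff (suc d) (suc k)
  uniformCoeff-strict d k = m<m+n (uniformCoeff d (suc k)) (uniformCoeff-pos d k)

  uniformCoeff-binomial : ∀ d k → uniformCoeff (suc d) k ≡ (d + k) C k
  uniformCoeff-binomial d       zero    = refl
  uniformCoeff-binomial zero    (suc k) =
    trans (uniformCoeff-binomial 0 k) (trans (nCn≡1 k) (sym (nCn≡1 (suc k))))
  uniformCoeff-binomial (suc d) (suc k) = begin
    uniformCoeff (suc d) (suc k) + uniformCoeff (suc (suc d)) k
      ≡⟨ cong₂ _+_ (uniformCoeff-binomial d (suc k)) (uniformCoeff-binomial (suc d) k) ⟩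
    (d + suc k) C suc k + suc (d + k) C k
      ≡⟨ cong (λ n → n C suc k + suc (d + k) C k) (+-suc d k) ⟩
    suc (d + k) C suc k + suc (d + k) C k
      ≡⟨ +-comm (suc (d + k) C suc k) _ ⟩
    suc (d + k) C k + suc (d + k) C suc k
      ≡⟨ nCk+nC[k+1]≡[n+1]C[k+1] (suc (d + k)) k ⟩
    suc (suc (d + k)) C suc k
      ≡⟨ cong (λ n → suc n C suc k) (sym (+-suc d k)) ⟩
    (suc d + suc k) C suc k ∎
    where open ≡-Reasoning

  uniformCoeff-corank : ∀ {m r i} → r < m → i ≤ r → uniformCoeff (m ∸ r) (r ∸ i) ≡ (m ∸ i ∸ 1) C (r ∸ i)
  uniformCoeff-corank {m} {r} {i} r<m i≤r = begin
    uniformCoeff (m ∸ r) (r ∸ i)        ≡⟨ cong (λ d → uniformCoeff d (r ∸ i)) (+-∸-assoc 1 r<m) ⟩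
    uniformCoeff (suc a) b              ≡⟨ uniformCoeff-binomial a b ⟩
    (a + b) C b                         ≡⟨ cong (_C b) a+b≡ ⟩
    (m ∸ i ∸ 1) C b                     ∎
    where
    open ≡-Reasoning
    a = m ∸ suc r
    b = r ∸ i
    a+b≡ : a + b ≡ m ∸ i ∸ 1
    a+b≡ = begin
      a + b                      ≡⟨ m+n∸n≡m (a + b) (suc i) ⟨
      a + b + suc i ∸ suc i      ≡⟨ cong (_∸ suc i) (trans (+-assoc a b (suc i)) (cong (a +_) (+-suc b i))) ⟩
      a + suc (b + i) ∸ suc i    ≡⟨ cong (λ x → a + suc x ∸ suc i) (m∸n+n≡m i≤r) ⟩
      a + suc r ∸ suc i          ≡⟨ cong (_∸ suc i) (m∸n+n≡m r<m) ⟩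
      m ∸ suc i                  ≡⟨ cong (m ∸_) (+-comm 1 i) ⟩
      m ∸ (i + 1)                ≡⟨ ∸-+-assoc m i 1 ⟨
      m ∸ i ∸ 1                  ∎

module Matroids {X : Set} where

  open import Data.Nat as ℕ using (ℕ; zero; suc; _∸_; _≤_; _<_; z≤n; s≤s)
  open import Data.Nat.Properties as ℕₚ
    using ( ≤-antisym; n≤1+n; m≤n+m; m∸n≤m; m∸n+n≡m; +-suc; +-∸-assoc; suc-injective; ≤∧≢⇒<; ≤-pred
          ; m∸n≡0⇒m≤n; m∸n≢0⇒n<m; m≤n⇒m⊓n≡m; m≤n⇒m<n∨m≡n; n∸n≡0; n<1+n)
  open import Data.Integer as ℤ using (ℤ; +_; 0ℤ; 1ℤ; _+_; +≤+; +<+)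
  open import Data.Integer.Properties as ℤₚ
    using (+-mono-≤; +-mono-<-≤; +-mono-≤-<; pos-+; +-identityʳ; +-inverseˡ; +-assoc)
  open import Data.List using (List; []; _∷_; [_]; length; map; take)
  open import Data.List.Properties using (length-take)
  open import Data.List.Relation.Unary.Any using (here)
  open import Data.List.Relation.Unary.All.Properties using (All¬⇒¬Any)
  open import Data.List.Relation.Unary.Unique.Propositional using (Unique)
  open import Data.List.Relation.Unary.AllPairs using (head; tail)
  open import Data.List.Relation.Binary.Equality.Propositional using (≋⇒≡)
  open import Data.List.Relation.Binary.Sublist.Propositional
    using (_⊆_; []; _∷_; _∷ʳ_; ⊆-refl; ⊆-trans; minimum; lookup)
  open import Data.List.Relation.Binary.Sublist.Propositional.Properties using (length-mono-≤; take-⊆; to-≋)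
  open import Data.Product using (∃-syntax; _×_; _,_)
  open import Data.Empty using (⊥-elim)
  open import Data.Bool using (if_then_else_)
  open import Relation.Nullary using (¬_; Dec; yes; no; does; _×-dec_)
  open import Data.Sum using (_⊎_; inj₁; inj₂)
  open import Relation.Unary using (Decidable)
  open import Relation.Binary.PropositionalEquality hiding ([_])
  open Polynomials
  open Subsets
  open UniformCoefficients

  -- Subsets of the ground set E are its sublists; augmentation happens inside a common F ⊆ E so
  -- that the augmented set is again a sublist.
  record IsMatroid (Ind : List X → Set) (E : List X) : Set where
    field
      unique  : Unique E
      ind-[]  : Ind []
      ind-⊆   : ∀ {A B} → A ⊆ B → B ⊆ E → Ind B → Ind A
      augment : ∀ {A B F} → A ⊆ F → B ⊆ F → F ⊆ E → Ind A → Ind B → length A < length B →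
                ∃[ A′ ] A ⊆ A′ × A′ ⊆ F × length A′ ≡ suc (length A) × Ind A′

  record IsRank (Ind : List X → Set) (E : List X) (r : ℕ) : Set where
    field
      basis        : List X
      basis-⊆      : basis ⊆ E
      basis-ind    : Ind basis
      basis-length : length basis ≡ r
      ind-length   : ∀ {A} → A ⊆ E → Ind A → length A ≤ r

  open IsMatroid
  open IsRank

  private
    variable
      Ind : List X → Set
      e : X
      E : List X
      r : ℕ

  ∷⊈ : Unique (e ∷ E) → ∀ {A} → ¬ (e ∷ A ⊆ E)
  ∷⊈ u e∷A⊆E = All¬⇒¬Any (head u) (lookup e∷A⊆E (here refl))

  delete : IsMatroid Ind (e ∷ E) → IsMatroid Ind E
  delete {e = e} M = record
    { unique  = tail (unique M)
    ; ind-[]  = ind-[] M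
    ; ind-⊆   = λ A⊆B B⊆E → ind-⊆ M A⊆B (e ∷ʳ B⊆E)
    ; augment = λ A⊆F B⊆F F⊆E → augment M A⊆F B⊆F (e ∷ʳ F⊆E) }

  contract : IsMatroid Ind (e ∷ E) → Ind [ e ] → IsMatroid (λ B → Ind (e ∷ B)) E
  contract {Ind} {e} {E} M ind-e = record
    { unique  = tail (unique M)
    ; ind-[]  = ind-e
    ; ind-⊆   = λ A⊆B B⊆E → ind-⊆ M (refl ∷ A⊆B) (refl ∷ B⊆E)
    ; augment = augment′ }
    where
    augment′ : ∀ {A B F} → A ⊆ F → B ⊆ F → F ⊆ E → Ind (e ∷ A) → Ind (e ∷ B) → length A < length B →
               ∃[ A′ ] A ⊆ A′ × A′ ⊆ F × length A′ ≡ suc (length A) × Ind (e ∷ A′)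
    augment′ A⊆F B⊆F F⊆E iA iB A<B with augment M (refl ∷ A⊆F) (refl ∷ B⊆F) (refl ∷ F⊆E) iA iB (s≤s A<B)
    ... | _      , A⊆A′        , _ ∷ʳ A′⊆F  , _   , _   = ⊥-elim (∷⊈ (unique M) (⊆-trans A⊆A′ (⊆-trans A′⊆F F⊆E)))
    ... | _ ∷ A′ , _ ∷ʳ A⊆A′   , refl ∷ A′⊆F , _   , _   = ⊥-elim (∷⊈ (unique M) (⊆-trans A⊆A′ (⊆-trans A′⊆F F⊆E)))
    ... | _ ∷ A′ , refl ∷ A⊆A′ , refl ∷ A′⊆F , len , iA′ = A′ , A⊆A′ , A′⊆F , suc-injective len , iA′

  extend-to-rank : IsMatroid Ind E → IsRank Ind E r → ∀ {C} → C ⊆ E → Ind C → length C ≤ r →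
                   ∃[ C′ ] C ⊆ C′ × C′ ⊆ E × Ind C′ × length C′ ≡ r
  extend-to-rank {Ind} {E} {r} M R {C} C⊆E iC C≤r = go (r ∸ length C) C⊆E iC (m∸n+n≡m C≤r)
    where
    go : ∀ n {C} → C ⊆ E → Ind C → n ℕ.+ length C ≡ r → ∃[ C′ ] C ⊆ C′ × C′ ⊆ E × Ind C′ × length C′ ≡ r
    go zero    C⊆E iC refl = _ , ⊆-refl , C⊆E , iC , refl
    go (suc n) {C} C⊆E iC eq
      with augment M C⊆E (basis-⊆ R) ⊆-refl iC (basis-ind R)
             (subst (length C <_) (trans eq (sym (basis-length R))) (s≤s (m≤n+m (length C) n)))
    ... | C₁ , C⊆C₁ , C₁⊆E , len , iC₁
      with go n C₁⊆E iC₁ (trans (cong (n ℕ.+_) len) (trans (+-suc n (length C)) eq))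
    ... | C′ , C₁⊆C′ , C′⊆E , iC′ , len′ = C′ , ⊆-trans C⊆C₁ C₁⊆C′ , C′⊆E , iC′ , len′

  ind-whole : IsRank Ind E r → length E ≤ r → Ind E
  ind-whole {Ind} R E≤r = subst Ind basis≡E (basis-ind R)
    where
    basis≡E = ≋⇒≡ (to-≋ (≤-antisym (length-mono-≤ (basis-⊆ R)) (subst (_ ≤_) (sym (basis-length R)) E≤r))
                         (basis-⊆ R))

  rank-delete : IsRank Ind (e ∷ E) r → ∀ {B} → B ⊆ E → Ind B → length B ≡ r → IsRank Ind E r
  rank-delete {e = e} R {B} B⊆E iB len = record
    { basis = B ; basis-⊆ = B⊆E ; basis-ind = iB ; basis-length = len
    ; ind-length = λ A⊆E → ind-length R (e ∷ʳ A⊆E) }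

  rank-contract : IsMatroid Ind (e ∷ E) → IsRank Ind (e ∷ E) (suc r) → Ind [ e ] →
    IsRank (λ B → Ind (e ∷ B)) E r
  rank-contract {Ind} {e} {E} {r} M R ind-e
    with extend-to-rank M R (refl ∷ minimum E) ind-e (s≤s z≤n)
  ... | _      , [e]⊆C , _ ∷ʳ C⊆E   , _  , _   = ⊥-elim (∷⊈ (unique M) (⊆-trans [e]⊆C C⊆E))
  ... | _ ∷ C  , _     , refl ∷ C⊆E , iC , len = record
    { basis = C ; basis-⊆ = C⊆E ; basis-ind = iC ; basis-length = suc-injective len
    ; ind-length = λ A⊆E iA → ≤-pred (ind-length R (refl ∷ A⊆E) iA) }

  HasIndependent : (List X → Set) → List X → ℕ → Set
  HasIndependent Ind E r = ∃[ B ] B ⊆ E × Ind B × length B ≡ r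

  hasIndependent? : Decidable Ind → ∀ E r → Dec (HasIndependent Ind E r)
  hasIndependent? Ind? E r = ∃-⊆? (λ B → Ind? B ×-dec (length B ℕ.≟ r)) E

  IsColoop : (List X → Set) → X → List X → Set
  IsColoop Ind e E = ∀ {B} → B ⊆ E → Ind B → Ind (e ∷ B)

  rank-delete-loop : IsMatroid Ind (e ∷ E) → ¬ Ind [ e ] → IsRank Ind (e ∷ E) r → IsRank Ind E r
  rank-delete-loop M loop R with basis R | basis-⊆ R | basis-ind R | basis-length R
  ... | B     | _ ∷ʳ B⊆E   | iB | len = rank-delete R B⊆E iB len
  ... | _ ∷ B | refl ∷ B⊆E | iB | _   = ⊥-elim (loop (ind-⊆ M (refl ∷ minimum B) (refl ∷ B⊆E) iB))

  rank-delete-coloop : IsMatroid Ind (e ∷ E) → IsRank Ind (e ∷ E) (suc r) → ¬ HasIndependent Ind E (suc r) →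
    IsRank Ind E r
  rank-delete-coloop {e = e} M R no-basis with basis R | basis-⊆ R | basis-ind R | basis-length R
  ... | B     | _ ∷ʳ B⊆E   | iB | len = ⊥-elim (no-basis (B , B⊆E , iB , len))
  ... | _ ∷ B | refl ∷ B⊆E | iB | len = record
    { basis = B ; basis-⊆ = B⊆E ; basis-ind = ind-⊆ M (e ∷ʳ ⊆-refl) (refl ∷ B⊆E) iB
    ; basis-length = suc-injective len
    ; ind-length = λ A⊆E iA →
        ≤-pred (≤∧≢⇒< (ind-length R (e ∷ʳ A⊆E) iA) (λ len → no-basis (_ , A⊆E , iA , len))) }

  -- Extend B to a basis C of E and augment C from a basis of e ∷ E: the new element must be e.
  coloop-extends : IsMatroid Ind (e ∷ E) → IsRank Ind (e ∷ E) (suc r) → ¬ HasIndependent Ind E (suc r) →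
    IsColoop Ind e E
  coloop-extends {Ind} {e} {E} {r} M R no-basis = extends (rank-delete-coloop M R no-basis)
    where
    extends : IsRank Ind E r → IsColoop Ind e E
    extends R′ B⊆E iB with extend-to-rank (delete M) R′ B⊆E iB (ind-length R′ B⊆E iB)
    ... | C , B⊆C , C⊆E , iC , lenC
      with augment M (e ∷ʳ C⊆E) (basis-⊆ R) ⊆-refl iC (basis-ind R)
             (subst (_< length (basis R)) (sym lenC) (ℕₚ.≤-reflexive (sym (basis-length R))))
    ... | A     , _        , _ ∷ʳ A⊆E   , lenA , iA = ⊥-elim (no-basis (A , A⊆E , iA , trans lenA (cong suc lenC)))
    ... | _ ∷ A , _ ∷ʳ C⊆A , refl ∷ A⊆E , _    , iA = ind-⊆ M (refl ∷ ⊆-trans B⊆C C⊆A) (refl ∷ A⊆E) iA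
    ... | _ ∷ A , refl ∷ _ , refl ∷ _   , _    , _  = ⊥-elim (∷⊈ (unique M) C⊆E)

  IndependentUpTo : (List X → Set) → List X → ℕ → Set
  IndependentUpTo Ind E k = ∀ {A} → A ⊆ E → length A ≤ k → Ind A

  DependentUpTo : (List X → Set) → List X → ℕ → Set
  DependentUpTo Ind E k = ∃[ A ] A ⊆ E × length A ≤ k × ¬ Ind A

  record SharpBound (Ind : List X → Set) (E : List X) (k u : ℕ) (s : ℤ) : Set where
    field
      bound  : s ℤ.≤ + u
      sharp  : IndependentUpTo Ind E k → s ≡ + u
      strict : DependentUpTo Ind E k → s ℤ.< + u

  open SharpBound

  independentUpTo-0 : IsMatroid Ind E → IndependentUpTo Ind E 0
  independentUpTo-0 M {[]}    _ _  = ind-[] M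
  independentUpTo-0 M {_ ∷ _} _ ()

  SharpBound-0 : IsMatroid Ind E → ∀ {s} → s ≡ 1ℤ → SharpBound Ind E 0 1 s
  SharpBound-0 M s≡1 = record
    { bound  = ℤₚ.≤-reflexive s≡1
    ; sharp  = λ _ → s≡1
    ; strict = λ { ([] , _ , _ , ¬i) → ⊥-elim (¬i (ind-[] M)) ; (_ ∷ _ , _ , () , _) } }

  SharpBound-loop : IsMatroid Ind (e ∷ E) → ¬ Ind [ e ] → ∀ {d k s} →
    SharpBound Ind E k (uniformCoeff d k) s → SharpBound Ind (e ∷ E) k (uniformCoeff (suc d) k) s
  SharpBound-loop M loop {k = zero} B = SharpBound-0 M (sharp B (independentUpTo-0 (delete M)))
  SharpBound-loop M loop {d} {suc k} B = record
    { bound  = ℤₚ.≤-trans (bound B) (+≤+ (uniformCoeff-mono d (suc k)))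
    ; sharp  = λ indep → ⊥-elim (loop (indep (refl ∷ minimum _) (s≤s z≤n)))
    ; strict = λ _ → ℤₚ.≤-<-trans (bound B) (+<+ (uniformCoeff-strict d k)) }

  SharpBound-delete-contract : ∀ {d k s₁ s₂} →
    SharpBound Ind E (suc k) (uniformCoeff d (suc k)) s₁ →
    SharpBound (λ B → Ind (e ∷ B)) E k (uniformCoeff (suc d) k) s₂ →
    SharpBound Ind (e ∷ E) (suc k) (uniformCoeff (suc d) (suc k)) (s₁ + s₂)
  SharpBound-delete-contract {Ind} {E} {e} {d} {k} {s₁} {s₂} B₁ B₂ = record
    { bound  = subst (s₁ + s₂ ℤ.≤_) u≡ (+-mono-≤ (bound B₁) (bound B₂))
    ; sharp  = λ indep → trans (cong₂ _+_ (sharp B₁ (λ A⊆E → indep (e ∷ʳ A⊆E)))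
                                          (sharp B₂ (λ A⊆E A≤k → indep (refl ∷ A⊆E) (s≤s A≤k)))) u≡
    ; strict = strict′ }
    where
    u≡ : + uniformCoeff d (suc k) + + uniformCoeff (suc d) k ≡ + uniformCoeff (suc d) (suc k)
    u≡ = sym (pos-+ (uniformCoeff d (suc k)) (uniformCoeff (suc d) k))
    strict′ : DependentUpTo Ind (e ∷ E) (suc k) → s₁ + s₂ ℤ.< + uniformCoeff (suc d) (suc k)
    strict′ (A , _ ∷ʳ A⊆E , A≤k , ¬i) =
      subst (s₁ + s₂ ℤ.<_) u≡ (+-mono-<-≤ (strict B₁ (A , A⊆E , A≤k , ¬i)) (bound B₂))
    strict′ (_ ∷ A , refl ∷ A⊆E , s≤s A≤k , ¬i) =
      subst (s₁ + s₂ ℤ.<_) u≡ (+-mono-≤-< (bound B₁) (strict B₂ (A , A⊆E , A≤k , ¬i)))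

  SharpBound-coloop : IsColoop Ind e E → ∀ {k u s} →
    SharpBound Ind E k u s → SharpBound Ind (e ∷ E) k u s
  SharpBound-coloop {Ind} {e} {E} coloop {k} {u} {s} B = record
    { bound  = bound B
    ; sharp  = λ indep → sharp B (λ A⊆E → indep (e ∷ʳ A⊆E))
    ; strict = strict′ }
    where
    strict′ : DependentUpTo Ind (e ∷ E) k → s ℤ.< + u
    strict′ (A , _ ∷ʳ A⊆E , A≤k , ¬i) = strict B (A , A⊆E , A≤k , ¬i)
    strict′ (_ ∷ A , refl ∷ A⊆E , A≤k , ¬i) =
      strict B (A , A⊆E , ℕₚ.≤-trans (n≤1+n _) A≤k , λ iA → ¬i (coloop A⊆E iA))

  SharpBound-coloop-0 : IsMatroid Ind (e ∷ E) → IsColoop Ind e E → IsRank Ind E r →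
    SharpBound Ind (e ∷ E) (suc r) (uniformCoeff (length E ∸ r) (suc r)) 0ℤ
  SharpBound-coloop-0 {Ind} {e} {E} {r} M coloop R with length E ∸ r in corank
  ... | zero  = record
    { bound  = +≤+ z≤n
    ; sharp  = λ _ → refl
    ; strict = λ (A , A⊆ , _ , ¬i) → ⊥-elim (¬i (ind-⊆ M A⊆ ⊆-refl ind-e∷E)) }
    where
    ind-e∷E : Ind (e ∷ E)
    ind-e∷E = coloop ⊆-refl (ind-whole R (m∸n≡0⇒m≤n corank))
  ... | suc d = record { bound = +≤+ z≤n ; sharp = too-small ; strict = λ _ → +<+ (uniformCoeff-pos d (suc r)) }
    where
    r<E : r < length E
    r<E = m∸n≢0⇒n<m (λ eq → 0≢1+n (trans (sym eq) corank))
      where open import Data.Nat.Properties using (0≢1+n)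
    take⊆E = take-⊆ (suc r) E
    take-length : length (take (suc r) E) ≡ suc r
    take-length = trans (length-take (suc r) E) (m≤n⇒m⊓n≡m r<E)
    too-small : IndependentUpTo Ind (e ∷ E) (suc r) → 0ℤ ≡ + uniformCoeff (suc d) (suc r)
    too-small indep = ⊥-elim (ℕₚ.<-irrefl refl (subst (_≤ r) take-length
      (ind-length R take⊆E (indep (e ∷ʳ take⊆E) (ℕₚ.≤-reflexive take-length)))))

  SharpBound-cong : ∀ {d d′ k k′ s s′} → d ≡ d′ → k ≡ k′ → s ≡ s′ →
    SharpBound Ind E k (uniformCoeff d k) s → SharpBound Ind E k′ (uniformCoeff d′ k′) s′
  SharpBound-cong refl refl refl B = B

  rank≤length : IsRank Ind E r → r ≤ length E
  rank≤length R = subst (_≤ _) (basis-length R) (length-mono-≤ (basis-⊆ R))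

  rank-[] : IsRank Ind [] r → r ≡ 0
  rank-[] R = ℕₚ.n≤0⇒n≡0 (rank≤length R)

  -- coeffSum Ind? r i E = Σ_{A ⊆ E independent} [x^i] (x-1)^{r-|A|} = [x^i] T(x,1) for rank r.
  indTerm : Decidable Ind → ℕ → ℕ → List X → ℤ
  indTerm Ind? r i A = if does (Ind? A) then coeff i (pow X-1 (r ∸ length A)) else 0ℤ

  indTerm-ind : (Ind? : Decidable Ind) → ∀ {r i A} → Ind A →
    indTerm Ind? r i A ≡ coeff i (pow X-1 (r ∸ length A))
  indTerm-ind Ind? {A = A} iA with Ind? A
  ... | yes _  = refl
  ... | no ¬iA = ⊥-elim (¬iA iA)

  indTerm-dep : (Ind? : Decidable Ind) → ∀ {r i A} → ¬ Ind A → indTerm Ind? r i A ≡ 0ℤ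
  indTerm-dep Ind? {A = A} ¬iA with Ind? A
  ... | yes iA = ⊥-elim (¬iA iA)
  ... | no _   = refl

  coeffSum : Decidable Ind → ℕ → ℕ → List X → ℤ
  coeffSum Ind? r i E = sumℤ (map (indTerm Ind? r i) (subsets E))

  coeffSum-> : (Ind? : Decidable Ind) → ∀ {i} → r < i → ∀ E → coeffSum Ind? r i E ≡ 0ℤ
  coeffSum-> {r = r} Ind? {i} r<i E = sum-zero-All (subsets-⊆ E) (λ {A} _ → vanish A)
    where
    vanish : ∀ A → indTerm Ind? r i A ≡ 0ℤ
    vanish A with Ind? A
    ... | yes _ = coeff-pow-X-1-> (ℕₚ.≤-<-trans (m∸n≤m r (length A)) r<i)
    ... | no  _ = refl

  coeffSum-loop : (Ind? : Decidable Ind) → IsMatroid Ind (e ∷ E) → ¬ Ind [ e ] → ∀ r i →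
    coeffSum Ind? r i (e ∷ E) ≡ coeffSum Ind? r i E
  coeffSum-loop {e = e} {E} Ind? M loop r i = begin
    coeffSum Ind? r i (e ∷ E)
      ≡⟨ sum-subsets-∷ (indTerm Ind? r i) e E ⟩
    coeffSum Ind? r i E + sumℤ (map (λ B → indTerm Ind? r i (e ∷ B)) (subsets E))
      ≡⟨ cong (_+_ (coeffSum Ind? r i E)) (sum-zero-All (subsets-⊆ E) vanish) ⟩
    coeffSum Ind? r i E + 0ℤ
      ≡⟨ +-identityʳ _ ⟩
    coeffSum Ind? r i E ∎
    where
    open ≡-Reasoning
    vanish : ∀ {B} → B ⊆ E → indTerm Ind? r i (e ∷ B) ≡ 0ℤ
    vanish {B} B⊆E with Ind? (e ∷ B)
    ... | yes iB = ⊥-elim (loop (ind-⊆ M (refl ∷ minimum B) (refl ∷ B⊆E) iB))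
    ... | no  _  = refl

  module _ (Ind? : Decidable Ind) (M : IsMatroid Ind (e ∷ E)) (coloop : IsColoop Ind e E)
           (R : IsRank Ind E r) where

    private
      coloop-term : ∀ i {B} → B ⊆ E → indTerm Ind? (suc r) i (e ∷ B) ≡ indTerm Ind? r i B
      coloop-term i {B} B⊆E with Ind? B | Ind? (e ∷ B)
      ... | yes _  | yes _  = refl
      ... | no  _  | no  _  = refl
      ... | yes iB | no ¬iB = ⊥-elim (¬iB (coloop B⊆E iB))
      ... | no ¬iB | yes iB = ⊥-elim (¬iB (ind-⊆ M (e ∷ʳ ⊆-refl) (refl ∷ B⊆E) iB))

      -- B and e ∷ B contribute (x-1)^{a+1} + (x-1)^a = x (x-1)^a, a = r - |B|.
      coeffSum-coloop : ∀ i → coeffSum Ind? (suc r) i (e ∷ E)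
        ≡ sumℤ (map (λ B → indTerm Ind? (suc r) i B + indTerm Ind? r i B) (subsets E))
      coeffSum-coloop i = begin
        coeffSum Ind? (suc r) i (e ∷ E)
          ≡⟨ sum-subsets-∷ (indTerm Ind? (suc r) i) e E ⟩
        coeffSum Ind? (suc r) i E + sumℤ (map (λ B → indTerm Ind? (suc r) i (e ∷ B)) (subsets E))
          ≡⟨ cong (_+_ (coeffSum Ind? (suc r) i E)) (sum-cong-All (subsets-⊆ E) (coloop-term i)) ⟩
        coeffSum Ind? (suc r) i E + coeffSum Ind? r i E
          ≡⟨ sym (sum-map-+ (indTerm Ind? (suc r) i) (indTerm Ind? r i) (subsets E)) ⟩
        sumℤ (map (λ B → indTerm Ind? (suc r) i B + indTerm Ind? r i B) (subsets E)) ∎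
        where open ≡-Reasoning

    coeffSum-coloop-0 : coeffSum Ind? (suc r) 0 (e ∷ E) ≡ 0ℤ
    coeffSum-coloop-0 = trans (coeffSum-coloop 0) (sum-zero-All (subsets-⊆ E) pair)
      where
      pair : ∀ {B} → B ⊆ E → indTerm Ind? (suc r) 0 B + indTerm Ind? r 0 B ≡ 0ℤ
      pair {B} B⊆E with Ind? B
      ... | no  _  = refl
      ... | yes iB rewrite +-∸-assoc 1 (ind-length R B⊆E iB) =
        trans (cong (_+ coeff 0 p) (coeff-X-1⊗-zero p)) (+-inverseˡ (coeff 0 p))
        where p = pow X-1 (r ∸ length B)

    coeffSum-coloop-suc : ∀ i → coeffSum Ind? (suc r) (suc i) (e ∷ E) ≡ coeffSum Ind? r i E
    coeffSum-coloop-suc i = trans (coeffSum-coloop (suc i)) (sum-cong-All (subsets-⊆ E) pair)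
      where
      pair : ∀ {B} → B ⊆ E → indTerm Ind? (suc r) (suc i) B + indTerm Ind? r (suc i) B ≡ indTerm Ind? r i B
      pair {B} B⊆E with Ind? B
      ... | no  _  = refl
      ... | yes iB rewrite +-∸-assoc 1 (ind-length R B⊆E iB) =
        trans (cong (_+ c (suc i)) (coeff-X-1⊗-suc i p))
              (trans (+-assoc (c i) (ℤ.- c (suc i)) (c (suc i)))
                     (trans (cong (_+_ (c i)) (+-inverseˡ (c (suc i)))) (+-identityʳ (c i))))
        where
        p = pow X-1 (r ∸ length B)
        c = λ j → coeff j p

  CoeffSumBounded : Decidable Ind → List X → ℕ → ℕ → Set
  CoeffSumBounded {Ind} Ind? E r i =
    SharpBound Ind E (r ∸ i) (uniformCoeff (length E ∸ r) (r ∸ i)) (coeffSum Ind? r i E)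

  CoeffSumBound : List X → Set₁
  CoeffSumBound E = ∀ {Ind} (Ind? : Decidable Ind) → IsMatroid Ind E →
    ∀ {r} → IsRank Ind E r → ∀ {i} → i ≤ r → CoeffSumBounded Ind? E r i

  coeffSum-bound-[] : CoeffSumBound []
  coeffSum-bound-[] {Ind} Ind? M R i≤r with rank-[] R
  ... | refl with i≤r
  ... | z≤n = SharpBound-0 M coeffSum≡1
    where
    coeffSum≡1 : coeffSum Ind? 0 0 [] ≡ 1ℤ
    coeffSum≡1 with Ind? []
    ... | yes _  = refl
    ... | no ¬i = ⊥-elim (¬i (ind-[] M))

  coeffSum-bound-loop : CoeffSumBound E → ∀ {Ind} (Ind? : Decidable Ind) → IsMatroid Ind (e ∷ E) →
    ∀ {r} → IsRank Ind (e ∷ E) r → ∀ {i} → i ≤ r → ¬ Ind [ e ] → CoeffSumBounded Ind? (e ∷ E) r i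
  coeffSum-bound-loop {E} ih Ind? M {r} R {i} i≤r loop =
    SharpBound-cong (sym (+-∸-assoc 1 (rank≤length R′))) refl (sym (coeffSum-loop Ind? M loop r i))
      (SharpBound-loop M loop (ih Ind? (delete M) R′ i≤r))
    where
    R′ = rank-delete-loop M loop R

  coeffSum-bound-coloop : CoeffSumBound E → ∀ {Ind} (Ind? : Decidable Ind) → IsMatroid Ind (e ∷ E) →
    ∀ {r} → IsRank Ind (e ∷ E) (suc r) → ∀ {i} → i ≤ suc r →
    ¬ HasIndependent Ind E (suc r) → CoeffSumBounded Ind? (e ∷ E) (suc r) i
  coeffSum-bound-coloop {E} {e} ih {Ind} Ind? M {r} R i≤r no-basis = by-i i≤r
    where
    R′ = rank-delete-coloop M R no-basis
    coloop = coloop-extends M R no-basis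
    by-i : ∀ {i} → i ≤ suc r → CoeffSumBounded Ind? (e ∷ E) (suc r) i
    by-i z≤n            = subst (SharpBound Ind (e ∷ E) _ _) (sym (coeffSum-coloop-0 Ind? M coloop R′))
                            (SharpBound-coloop-0 M coloop R′)
    by-i (s≤s {i} i≤r′) = subst (SharpBound Ind (e ∷ E) _ _) (sym (coeffSum-coloop-suc Ind? M coloop R′ i))
                            (SharpBound-coloop coloop (ih Ind? (delete M) R′ i≤r′))

  coeffSum-bound-delete-contract : CoeffSumBound E → ∀ {Ind} (Ind? : Decidable Ind) → IsMatroid Ind (e ∷ E) →
    ∀ {r} → IsRank Ind (e ∷ E) (suc r) → ∀ {i} → i ≤ suc r → Ind [ e ] →
    HasIndependent Ind E (suc r) → CoeffSumBounded Ind? (e ∷ E) (suc r) i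
  coeffSum-bound-delete-contract {E} {e} ih {Ind} Ind? M {r} R {i} i≤r ind-e (B , B⊆E , iB , lenB) =
    by-i (m≤n⇒m<n∨m≡n i≤r)
    where
    Ind?ₑ : Decidable (λ B → Ind (e ∷ B))
    Ind?ₑ B = Ind? (e ∷ B)
    R₁ : IsRank Ind E (suc r)
    R₁ = rank-delete R B⊆E iB lenB
    -- The terms of the subsets e ∷ B are, definitionally, those of the contraction at rank r.
    split : coeffSum Ind? (suc r) i (e ∷ E) ≡ coeffSum Ind? (suc r) i E + coeffSum Ind?ₑ r i E
    split = sum-subsets-∷ (indTerm Ind? (suc r) i) e E
    IH₁ : CoeffSumBounded Ind? E (suc r) i
    IH₁ = ih Ind? (delete M) R₁ i≤r
    by-i : i < suc r ⊎ i ≡ suc r → CoeffSumBounded Ind? (e ∷ E) (suc r) i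
    by-i (inj₁ (s≤s i≤r′)) = SharpBound-cong (sym d≡) (sym k≡) (sym split) (SharpBound-delete-contract B₁ B₂)
      where
      k≡ : suc r ∸ i ≡ suc (r ∸ i)
      k≡ = +-∸-assoc 1 i≤r′
      d≡ : length E ∸ r ≡ suc (length E ∸ suc r)
      d≡ = +-∸-assoc 1 (rank≤length R₁)
      B₁ : SharpBound Ind E (suc (r ∸ i)) (uniformCoeff (length E ∸ suc r) (suc (r ∸ i)))
                      (coeffSum Ind? (suc r) i E)
      B₁ = SharpBound-cong {d = length E ∸ suc r} refl k≡ refl IH₁
      B₂ : SharpBound (λ B → Ind (e ∷ B)) E (r ∸ i) (uniformCoeff (suc (length E ∸ suc r)) (r ∸ i))
                      (coeffSum Ind?ₑ r i E)
      B₂ = SharpBound-cong d≡ refl refl (ih Ind?ₑ (contract M ind-e) (rank-contract M R ind-e) i≤r′)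
    by-i (inj₂ refl) =
      SharpBound-cong {d = length E ∸ r} refl (sym (n∸n≡0 r)) refl
        (SharpBound-0 M (trans split (cong₂ _+_ s₁≡1 (coeffSum-> Ind?ₑ (n<1+n r) E))))
      where
      s₁≡1 : coeffSum Ind? (suc r) (suc r) E ≡ 1ℤ
      s₁≡1 = sharp (SharpBound-cong {d = length E ∸ suc r} refl (n∸n≡0 r) refl IH₁)
                   (independentUpTo-0 (delete M))

  coeffSum-bound : ∀ E → CoeffSumBound E
  coeffSum-bound []      = coeffSum-bound-[]
  coeffSum-bound (e ∷ E) Ind? M R i≤r with Ind? [ e ]
  ... | no loop = coeffSum-bound-loop (coeffSum-bound E) Ind? M R i≤r loop
  coeffSum-bound (e ∷ E) Ind? M {zero} R i≤r | yes ind-e =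
    ⊥-elim (ℕₚ.<-irrefl refl (ind-length R (refl ∷ minimum E) ind-e))
  coeffSum-bound (e ∷ E) Ind? M {suc r} R i≤r | yes ind-e with hasIndependent? Ind? E (suc r)
  ... | yes basis′ = coeffSum-bound-delete-contract (coeffSum-bound E) Ind? M R i≤r ind-e basis′
  ... | no ¬basis′ = coeffSum-bound-coloop (coeffSum-bound E) Ind? M R i≤r ¬basis′

module ListFacts {A : Set} where

  open import Data.Nat using (suc; _≤_; z≤n; s≤s)
  open import Data.Nat.Properties using (≤-trans; ≤-reflexive)
  open import Data.List using (List; []; _∷_; _++_; length; map)
  open import Data.List.Properties using (length-++-sucʳ)
  open import Data.List.Membership.Propositional using (_∈_)
  open import Data.List.Membership.Propositional.Properties using (∈-∃++; ∈-++⁻; ∈-++⁺ˡ; ∈-++⁺ʳ)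
  open import Data.List.Relation.Unary.Any using (here; there)
  open import Data.List.Relation.Unary.All using (All; []; _∷_)
  open import Data.List.Relation.Unary.All.Properties using (All¬⇒¬Any)
  open import Data.List.Relation.Unary.Unique.Propositional using (Unique)
  open import Data.List.Relation.Unary.AllPairs using ([]; _∷_)
  open import Data.List.Relation.Binary.Subset.Propositional using () renaming (_⊆_ to _⊑_)
  open import Data.List.Relation.Binary.Sublist.Propositional using (_⊆_; []; _∷_; _∷ʳ_; ⊆-refl)
  open import Data.List.Relation.Binary.Sublist.Propositional.Properties using (All-resp-⊆)
  open import Data.Product using (∃-syntax; _×_; _,_)
  open import Data.Sum using (inj₁; inj₂)
  open import Data.Empty using (⊥-elim)
  open import Relation.Nullary using (¬_)
  open import Relation.Binary.PropositionalEquality using (_≡_; refl; sym; cong)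

  -- xs ⊑ ys is membership inclusion, xs ⊆ ys the sublist order.
  length-≤-Unique : ∀ {xs ys : List A} → Unique xs → xs ⊑ ys → length xs ≤ length ys
  length-≤-Unique {[]}     _          _      = z≤n
  length-≤-Unique {x ∷ xs} (x∉xs ∷ u) xs⊑ys with ∈-∃++ (xs⊑ys (here refl))
  ... | ys₁ , ys₂ , refl =
    ≤-trans (s≤s (length-≤-Unique u xs⊑ys₁++ys₂)) (≤-reflexive (sym (length-++-sucʳ ys₁ x ys₂)))
    where
    xs⊑ys₁++ys₂ : xs ⊑ ys₁ ++ ys₂
    xs⊑ys₁++ys₂ y∈xs with ∈-++⁻ ys₁ (xs⊑ys (there y∈xs))
    ... | inj₁ y∈ys₁         = ∈-++⁺ˡ y∈ys₁
    ... | inj₂ (here refl)   = ⊥-elim (All¬⇒¬Any x∉xs y∈xs)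
    ... | inj₂ (there y∈ys₂) = ∈-++⁺ʳ ys₁ y∈ys₂

  Unique-map⁺-on : ∀ {B : Set} {P : A → Set} {g : A → B} → (∀ {x y} → P x → P y → g x ≡ g y → x ≡ y) →
    ∀ {xs} → All P xs → Unique xs → Unique (map g xs)
  Unique-map⁺-on {P = P} {g} inj = go
    where
    images-distinct : ∀ {x} → P x → ∀ {ys} → All P ys → All (λ y → ¬ x ≡ y) ys →
                      All (λ z → ¬ g x ≡ z) (map g ys)
    images-distinct px []         []         = []
    images-distinct px (py ∷ pys) (x≢y ∷ ne) = (λ gx≡gy → x≢y (inj px py gx≡gy)) ∷ images-distinct px pys ne
    go : ∀ {xs} → All P xs → Unique xs → Unique (map g xs)
    go []         []          = []
    go (px ∷ pxs) (x∉xs ∷ u) = images-distinct px pxs x∉xs ∷ go pxs u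

  ⊆-insert : ∀ {xs ys : List A} {x} → xs ⊆ ys → x ∈ ys → ¬ x ∈ xs →
    ∃[ zs ] xs ⊆ zs × zs ⊆ ys × length zs ≡ suc (length xs) × x ∈ zs
  ⊆-insert {x = x} (_ ∷ʳ xs⊆ys) (here refl) x∉xs = _ , x ∷ʳ ⊆-refl , refl ∷ xs⊆ys , refl , here refl
  ⊆-insert (y ∷ʳ xs⊆ys) (there x∈ys) x∉xs with ⊆-insert xs⊆ys x∈ys x∉xs
  ... | zs , xs⊆zs , zs⊆ys , len , x∈zs = zs , xs⊆zs , y ∷ʳ zs⊆ys , len , x∈zs
  ⊆-insert (refl ∷ xs⊆ys) (here refl) x∉xs = ⊥-elim (x∉xs (here refl))
  ⊆-insert {ys = y ∷ _} (refl ∷ xs⊆ys) (there x∈ys) x∉xs with ⊆-insert xs⊆ys x∈ys (λ x∈xs → x∉xs (there x∈xs))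
  ... | zs , xs⊆zs , zs⊆ys , len , x∈zs = y ∷ zs , refl ∷ xs⊆zs , refl ∷ zs⊆ys , cong suc len , there x∈zs

  Unique-⊆ : ∀ {xs ys : List A} → xs ⊆ ys → Unique ys → Unique xs
  Unique-⊆ []            []         = []
  Unique-⊆ (_ ∷ʳ xs⊆ys)  (_ ∷ u)    = Unique-⊆ xs⊆ys u
  Unique-⊆ (refl ∷ xs⊆ys) (x∉ys ∷ u) = All-resp-⊆ xs⊆ys x∉ys ∷ Unique-⊆ xs⊆ys u

module Counting where

  open import Data.Nat using (zero; suc; _+_; _≤_; z≤n; s≤s)
  open import Data.Nat.Properties using (m≤n⇒m≤1+n; +-suc; module ≤-Reasoning)
  open import Data.Fin using (Fin; zero; suc)
  open import Data.Fin.Properties using (suc-injective) renaming (_≟_ to _≟ᶠ_)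
  open import Data.List using (length; map; filter; tabulate; allFin)
  open import Data.List.Properties using (length-map)
  open import Data.List.Membership.Propositional using (_∈_)
  open import Data.List.Membership.Propositional.Properties using (∈-map⁻; ∈-filter⁺; ∈-filter⁻; ∈-allFin)
  import Data.List.Relation.Unary.All as All
  open import Data.List.Relation.Unary.Unique.Propositional.Properties using (filter⁺; allFin⁺)
  open import Data.Product using (_,_; proj₂)
  open import Data.Bool using (Bool; true; false; if_then_else_)
  open import Function using (_∘_; id)
  open import Relation.Nullary using (¬_; does)
  open import Relation.Unary using (Decidable)
  open import Relation.Binary.PropositionalEquality
  open ListFacts

  count-filter : ∀ {A : Set} {P : A → Set} (P? : Decidable P) {n} (f : Fin n → A) →
    count (λ v → does (P? (f v))) ≡ length (filter P? (tabulate f))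
  count-filter P? {zero}  f = refl
  count-filter P? {suc n} f with does (P? (f zero))
  ... | true  = cong suc (count-filter P? (f ∘ suc))
  ... | false = count-filter P? (f ∘ suc)

  count-cong : ∀ {n} {p q : Fin n → Bool} → (∀ v → p v ≡ q v) → count p ≡ count q
  count-cong {zero}  p≗q = refl
  count-cong {suc n} p≗q = cong₂ (λ b c → (if b then 1 else 0) + c) (p≗q zero) (count-cong (p≗q ∘ suc))

  count-≤ : ∀ {n} (p : Fin n → Bool) → count p ≤ n
  count-≤ {zero}  p = z≤n
  count-≤ {suc n} p with p zero
  ... | true  = s≤s (count-≤ (p ∘ suc))
  ... | false = m≤n⇒m≤1+n (count-≤ (p ∘ suc))

  count-true : ∀ {n} {p : Fin n → Bool} → (∀ v → p v ≡ true) → count p ≡ n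
  count-true {zero}  p≡true = refl
  count-true {suc n} p≡true rewrite p≡true zero = cong suc (count-true (p≡true ∘ suc))

  count-except : ∀ {n} {p q : Fin n → Bool} (z : Fin n) → p z ≡ true → q z ≡ false →
    (∀ v → ¬ v ≡ z → p v ≡ q v) → count p ≡ suc (count q)
  count-except {suc n} zero pz qz p≗q rewrite pz | qz = cong suc (count-cong (λ v → p≗q (suc v) λ ()))
  count-except {suc n} {p} {q} (suc z) pz qz p≗q rewrite p≗q zero (λ ()) =
    trans (cong ((if q zero then 1 else 0) +_)
                (count-except z pz qz (λ v v≢z → p≗q (suc v) (v≢z ∘ suc-injective))))
          (+-suc _ _)

  -- x ↦ g x maps the fixed points of f injectively to fixed points of g.
  count-fixpoints-≤ : ∀ {n} (f g : Fin n → Fin n) → (∀ {v w} → g v ≡ g w → f v ≡ f w) → (∀ v → g (g v) ≡ g v) →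
    count (λ v → does (f v ≟ᶠ v)) ≤ count (λ v → does (g v ≟ᶠ v))
  count-fixpoints-≤ {n} f g g-finer g-idem = begin
    count (λ v → does (f v ≟ᶠ v))  ≡⟨ count-filter fixed-f? id ⟩
    length fixed-f                 ≡⟨ length-map g fixed-f ⟨
    length (map g fixed-f)         ≤⟨ length-≤-Unique unique-images images-fixed ⟩
    length fixed-g                 ≡⟨ count-filter fixed-g? id ⟨
    count (λ v → does (g v ≟ᶠ v))  ∎
    where
    open ≤-Reasoning
    fixed-f? = λ v → f v ≟ᶠ v
    fixed-g? = λ v → g v ≟ᶠ v
    fixed-f = filter fixed-f? (allFin n)
    fixed-g = filter fixed-g? (allFin n)
    unique-images = Unique-map⁺-on (λ fx≡x fy≡y gx≡gy → trans (sym fx≡x) (trans (g-finer gx≡gy) fy≡y))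
      (All.tabulate (proj₂ ∘ ∈-filter⁻ fixed-f? {xs = allFin n})) (filter⁺ fixed-f? (allFin⁺ n))
    images-fixed : ∀ {y} → y ∈ map g fixed-f → y ∈ fixed-g
    images-fixed y∈ with ∈-map⁻ g y∈
    ... | x , _ , refl = ∈-filter⁺ fixed-g? (∈-allFin (g x)) (g-idem x)

module Connectivity {n : ℕ} where

  open import Data.Nat using (suc; _∸_; _≤_; s≤s)
  open import Data.Nat.Properties using (≤-trans; ≤-reflexive; m≤n⇒m≤1+n; ∸-monoʳ-≤; n∸n≡0; +-∸-assoc)
  open import Data.Fin using (Fin)
  open import Data.Fin.Properties using () renaming (_≟_ to _≟ᶠ_)
  open import Data.List using (List; []; _∷_; length)
  open import Data.List.Membership.Propositional using (_∈_)
  open import Data.List.Relation.Unary.Any using (here; there)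
  open import Data.List.Relation.Binary.Subset.Propositional using () renaming (_⊆_ to _⊑_)
  open import Data.Product using (_×_; _,_)
  open import Data.Sum using (_⊎_; inj₁; inj₂)
  import Data.Sum as Sum
  open import Data.Empty using (⊥-elim)
  open import Data.Bool using (false)
  open import Relation.Nullary using (¬_; Dec; yes; no; does)
  open import Relation.Nullary.Decidable using (dec-true; dec-false)
  open import Relation.Binary.PropositionalEquality
  open import Relation.Binary.Construct.Closure.ReflexiveTransitive
    using (Star; ε; _◅_; _◅◅_; return; reverse; fold) renaming (map to Star-map)
  open Counting

  Adjacent : List (Edge n) → Fin n → Fin n → Set
  Adjacent A a b = (a , b) ∈ A ⊎ (b , a) ∈ A

  Connected : List (Edge n) → Fin n → Fin n → Set
  Connected A = Star (Adjacent A)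

  private
    variable
      A B : List (Edge n)
      u v w : Fin n

  connected-sym : Connected A u v → Connected A v u
  connected-sym = reverse Sum.swap

  connected-mono : A ⊑ B → Connected A u v → Connected B u v
  connected-mono A⊑B = Star-map (Sum.map A⊑B A⊑B)

  edge-connected : (u , v) ∈ A → Connected A u v
  edge-connected uv∈A = return (inj₁ uv∈A)

  merge-cases : (lab : Labelling n) (u w v : Fin n) →
    (lab v ≡ lab w × merge lab (u , w) v ≡ lab u) ⊎ (¬ lab v ≡ lab w × merge lab (u , w) v ≡ lab v)
  merge-cases lab u w v with lab v ≟ᶠ lab w
  ... | yes eq = inj₁ (eq , refl)
  ... | no  ne = inj₂ (ne , refl)

  merge-cong : (lab : Labelling n) (e : Edge n) → lab v ≡ lab w → merge lab e v ≡ merge lab e w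
  merge-cong {v} {w} lab (a , b) eq with merge-cases lab a b v | merge-cases lab a b w
  ... | inj₁ (_ , x)  | inj₁ (_ , y)  = trans x (sym y)
  ... | inj₁ (p , _)  | inj₂ (q , _)  = ⊥-elim (q (trans (sym eq) p))
  ... | inj₂ (p , _)  | inj₁ (q , _)  = ⊥-elim (p (trans eq q))
  ... | inj₂ (_ , x)  | inj₂ (_ , y)  = trans x (trans eq (sym y))

  labels-edge : ∀ A → (u , v) ∈ A → labels A u ≡ labels A v
  labels-edge ((a , b) ∷ A) (here refl) with merge-cases (labels A) a b a | merge-cases (labels A) a b b
  ... | _            | inj₂ (ne , _) = ⊥-elim (ne refl)
  ... | inj₁ (_ , x) | inj₁ (_ , y)  = trans x (sym y)
  ... | inj₂ (_ , x) | inj₁ (_ , y)  = trans x (sym y)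
  labels-edge (e ∷ A) (there uv∈A) = merge-cong (labels A) e (labels-edge A uv∈A)

  labels-sound : Connected A u v → labels A u ≡ labels A v
  labels-sound {A} = fold (λ u v → labels A u ≡ labels A v) step refl
    where
    step : ∀ {u v w} → Adjacent A u v → labels A v ≡ labels A w → labels A u ≡ labels A w
    step (inj₁ uv∈A) eq = trans (labels-edge A uv∈A) eq
    step (inj₂ vu∈A) eq = trans (sym (labels-edge A vu∈A)) eq

  private
    lift : ∀ {e} → Connected A u v → Connected (e ∷ A) u v
    lift = connected-mono there

  labels-complete : ∀ A → labels A u ≡ labels A v → Connected A u v
  labels-complete []                refl = ε
  labels-complete {u} {v} ((a , b) ∷ A) eq with merge-cases (labels A) a b u | merge-cases (labels A) a b v
  ... | inj₁ (p , _) | inj₁ (q , _) = lift (labels-complete A (trans p (sym q)))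
  ... | inj₁ (p , x) | inj₂ (_ , y) =
    lift (labels-complete A p) ◅◅ inj₂ (here refl) ◅ lift (labels-complete A (trans (sym x) (trans eq y)))
  ... | inj₂ (_ , x) | inj₁ (q , y) =
    lift (labels-complete A (trans (sym x) (trans eq y))) ◅◅ inj₁ (here refl) ◅ lift (labels-complete A (sym q))
  ... | inj₂ (_ , x) | inj₂ (_ , y) = lift (labels-complete A (trans (sym x) (trans eq y)))

  connected-label : ∀ A v → Connected A (labels A v) v
  connected-label []            v = ε
  connected-label ((a , b) ∷ A) v with merge-cases (labels A) a b v
  ... | inj₁ (p , x) rewrite x =
    lift (connected-label A a) ◅◅ inj₁ (here refl) ◅ lift (labels-complete A (sym p))
  ... | inj₂ (_ , x) rewrite x = lift (connected-label A v)

  labels-idem : ∀ A v → labels A (labels A v) ≡ labels A v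
  labels-idem A v = labels-sound (connected-label A v)

  connected? : ∀ A u v → Dec (Connected A u v)
  connected? A u v with labels A u ≟ᶠ labels A v
  ... | yes eq = yes (labels-complete A eq)
  ... | no  ne = no (λ c → ne (labels-sound c))

  components-∷-connected : Connected A u w → components ((u , w) ∷ A) ≡ components A
  components-∷-connected {A} {u} {w} u~w = count-cong same
    where
    same : ∀ v → does (merge (labels A) (u , w) v ≟ᶠ v) ≡ does (labels A v ≟ᶠ v)
    same v with merge-cases (labels A) u w v
    ... | inj₁ (p , x) = cong (λ l → does (l ≟ᶠ v)) (trans x (trans (labels-sound u~w) (sym p)))
    ... | inj₂ (_ , x) = cong (λ l → does (l ≟ᶠ v)) x

  -- The class of w loses its representative labels A w; every other fixed point survives.
  components-∷-new : ¬ Connected A u w → components A ≡ suc (components ((u , w) ∷ A))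
  components-∷-new {A} {u} {w} ¬u~w =
    count-except (lab w) (dec-true (lab (lab w) ≟ᶠ lab w) (labels-idem A w)) lost kept
    where
    lab = labels A
    lab-u≢lab-w : ¬ lab u ≡ lab w
    lab-u≢lab-w eq = ¬u~w (labels-complete A eq)
    lost : does (merge lab (u , w) (lab w) ≟ᶠ lab w) ≡ false
    lost with merge-cases lab u w (lab w)
    ... | inj₁ (_ , x) rewrite x = dec-false (lab u ≟ᶠ lab w) lab-u≢lab-w
    ... | inj₂ (ne , _) = ⊥-elim (ne (labels-idem A w))
    kept : ∀ v → ¬ v ≡ lab w → does (lab v ≟ᶠ v) ≡ does (merge lab (u , w) v ≟ᶠ v)
    kept v v≢lab-w with merge-cases lab u w v
    ... | inj₂ (_ , x) rewrite x = refl
    ... | inj₁ (p , x) rewrite x =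
      trans (dec-false (lab v ≟ᶠ v) (λ eq → v≢lab-w (trans (sym eq) p)))
            (sym (dec-false (lab u ≟ᶠ v)
                   (λ eq → lab-u≢lab-w (trans (sym (labels-idem A u)) (trans (cong lab eq) p)))))

  components≤n : ∀ (A : List (Edge n)) → components A ≤ n
  components≤n A = count-≤ (λ v → does (labels A v ≟ᶠ v))

  components-antitone : (∀ {u v} → Connected A u v → Connected B u v) → components B ≤ components A
  components-antitone {A} {B} A⇒B =
    count-fixpoints-≤ (labels B) (labels A) (λ eq → labels-sound (A⇒B (labels-complete A eq))) (labels-idem A)

  rk-[] : rk {n} [] ≡ 0
  rk-[] = trans (cong (n ∸_) (count-true {n} {λ v → does (v ≟ᶠ v)} (λ v → dec-true (v ≟ᶠ v) refl))) (n∸n≡0 n)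

  rk-∷-connected : Connected A u w → rk ((u , w) ∷ A) ≡ rk A
  rk-∷-connected u~w = cong (n ∸_) (components-∷-connected u~w)

  rk-∷-new : ¬ Connected A u w → rk ((u , w) ∷ A) ≡ suc (rk A)
  rk-∷-new {A} ¬u~w = trans (+-∸-assoc 1 (subst (_≤ n) (components-∷-new ¬u~w) (components≤n A)))
                             (cong (λ c → suc (n ∸ c)) (sym (components-∷-new ¬u~w)))

  rk≤length : ∀ A → rk A ≤ length A
  rk≤length []            = ≤-reflexive rk-[]
  rk≤length ((u , w) ∷ A) with connected? A u w
  ... | yes u~w  = ≤-trans (≤-reflexive (rk-∷-connected u~w)) (m≤n⇒m≤1+n (rk≤length A))
  ... | no ¬u~w = ≤-trans (≤-reflexive (rk-∷-new ¬u~w)) (s≤s (rk≤length A))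

  rk-mono : (∀ {u v} → Connected A u v → Connected B u v) → rk A ≤ rk B
  rk-mono A⇒B = ∸-monoʳ-≤ n (components-antitone A⇒B)

module Forests {n : ℕ} where

  open import Data.Nat using (suc; _≤_; _<_; _≤?_; z≤n; s≤s)
  open import Data.Nat.Properties using (≤-trans; ≤-reflexive; ≤-pred; <-irrefl; module ≤-Reasoning)
  open import Data.Fin using (Fin)
  open import Data.List using (List; []; _∷_; length)
  open import Data.List.Membership.Propositional using (_∈_; find)
  open import Data.List.Relation.Unary.Any using (here; there)
  import Data.List.Relation.Unary.All as All
  open import Data.List.Relation.Unary.All.Properties using (¬All⇒Any¬)
  open import Data.List.Relation.Unary.Unique.Propositional using (Unique)
  open import Data.List.Relation.Binary.Sublist.Propositional using (_⊆_; []; _∷_; _∷ʳ_; lookup)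
  open import Data.Product using (∃-syntax; _×_; _,_; proj₁)
  open import Data.Sum using (inj₁; inj₂)
  open import Data.Empty using (⊥-elim)
  open import Function using (_∘_)
  open import Relation.Nullary using (¬_; yes; no)
  open import Relation.Unary using (Decidable)
  open import Relation.Binary.PropositionalEquality
  open import Relation.Binary.Construct.Closure.ReflexiveTransitive using (_⋆)
  open Connectivity {n}
  open Matroids {Edge n} using (IsMatroid; IsRank)
  open ListFacts using (⊆-insert)

  -- As rk A ≤ |A| always (rk≤length), this says rk A = |A|.
  Forest : List (Edge n) → Set
  Forest A = length A ≤ rk A

  forest? : Decidable Forest
  forest? A = length A ≤? rk A

  private
    variable
      A B F : List (Edge n)
      u w : Fin n

  forest-∷⁻ : Forest ((u , w) ∷ A) → Forest A × ¬ Connected A u w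
  forest-∷⁻ {u} {w} {A} f with connected? A u w
  ... | yes u~w = ⊥-elim (<-irrefl refl (≤-trans f (≤-trans (≤-reflexive (rk-∷-connected u~w)) (rk≤length A))))
  ... | no ¬u~w = ≤-pred (≤-trans f (≤-reflexive (rk-∷-new ¬u~w))) , ¬u~w

  forest-∷⁺ : Forest A → ¬ Connected A u w → Forest ((u , w) ∷ A)
  forest-∷⁺ f ¬u~w = ≤-trans (s≤s f) (≤-reflexive (sym (rk-∷-new ¬u~w)))

  forest-⊆ : A ⊆ B → Forest B → Forest A
  forest-⊆ []            _ = z≤n
  forest-⊆ {B = _ ∷ B} (_ ∷ʳ A⊆B)   f = forest-⊆ A⊆B (proj₁ (forest-∷⁻ {A = B} f))
  forest-⊆ {B = _ ∷ B} (refl ∷ A⊆B) f with forest-∷⁻ {A = B} f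
  ... | fB , ¬u~w = forest-∷⁺ (forest-⊆ A⊆B fB) (¬u~w ∘ connected-mono (lookup A⊆B))

  forest-augment : A ⊆ F → B ⊆ F → Forest A → Forest B → length A < length B →
    ∃[ A′ ] A ⊆ A′ × A′ ⊆ F × length A′ ≡ suc (length A) × Forest A′
  forest-augment {A} {F} {B} A⊆F B⊆F fA fB A<B with All.all? (λ (u , w) → connected? A u w) B
  ... | yes B-spanned = ⊥-elim (<-irrefl refl (begin-strict
    length A  <⟨ A<B ⟩
    length B  ≤⟨ fB ⟩
    rk B      ≤⟨ rk-mono (spanned ⋆) ⟩
    rk A      ≤⟨ rk≤length A ⟩
    length A  ∎))
    where
    open ≤-Reasoning
    spanned : ∀ {a b} → Adjacent B a b → Connected A a b
    spanned (inj₁ ab∈B) = All.lookup B-spanned ab∈B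
    spanned (inj₂ ba∈B) = connected-sym (All.lookup B-spanned ba∈B)
  ... | no ¬spanned with find (¬All⇒Any¬ (λ (u , w) → connected? A u w) B ¬spanned)
  ... | (u , w) , uw∈B , ¬u~w with ⊆-insert A⊆F (lookup B⊆F uw∈B) (¬u~w ∘ edge-connected)
  ... | A′ , A⊆A′ , A′⊆F , len , uw∈A′ = A′ , A⊆A′ , A′⊆F , len , (begin
    length A′               ≡⟨ len ⟩
    suc (length A)          ≤⟨ s≤s fA ⟩
    suc (rk A)              ≡⟨ rk-∷-new ¬u~w ⟨
    rk ((u , w) ∷ A)        ≤⟨ rk-mono (connected-mono uw∷A⊑A′) ⟩
    rk A′                   ∎)
    where
    open ≤-Reasoning
    uw∷A⊑A′ : ∀ {e} → e ∈ (u , w) ∷ A → e ∈ A′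
    uw∷A⊑A′ (here refl) = uw∈A′
    uw∷A⊑A′ (there e∈A) = lookup A⊆A′ e∈A

  spanning-forest : ∀ L → ∃[ B ] B ⊆ L × Forest B × length B ≡ rk L
  spanning-forest []            = [] , [] , z≤n , sym rk-[]
  spanning-forest ((u , w) ∷ L) with spanning-forest L | connected? L u w
  ... | B , B⊆L , fB , len | yes u~w = B , _ ∷ʳ B⊆L , fB , trans len (sym (rk-∷-connected u~w))
  ... | B , B⊆L , fB , len | no ¬u~w =
    _ , refl ∷ B⊆L , forest-∷⁺ fB (¬u~w ∘ connected-mono (lookup B⊆L)) ,
    trans (cong suc len) (sym (rk-∷-new ¬u~w))

  forest-matroid : Unique F → IsMatroid Forest F
  forest-matroid u = record
    { unique  = u
    ; ind-[]  = z≤n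
    ; ind-⊆   = λ A⊆B _ → forest-⊆ A⊆B
    ; augment = λ A⊆F B⊆F _ → forest-augment A⊆F B⊆F }

  forest-rank : ∀ F → IsRank Forest F (rk F)
  forest-rank F with spanning-forest F
  ... | B , B⊆F , fB , len = record
    { basis = B ; basis-⊆ = B⊆F ; basis-ind = fB ; basis-length = len
    ; ind-length = λ A⊆F fA → ≤-trans fA (rk-mono (connected-mono (lookup A⊆F))) }

module Paths {n : ℕ} where

  open import Data.Nat using (suc)
  open import Data.Fin using (Fin) renaming (_≟_ to _≟ᶠ_)
  open import Data.List using (List; []; _∷_; [_]; length)
  open import Data.List.Membership.Propositional using (_∈_)
  open import Data.List.Relation.Unary.Any using (here; there; any?)
  open import Data.List.Relation.Unary.All using ([])
  open import Data.List.Relation.Unary.All.Properties using (¬Any⇒All¬; All¬⇒¬Any)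
  open import Data.List.Relation.Unary.Unique.Propositional using (Unique)
  open import Data.List.Relation.Unary.AllPairs using ([]; _∷_)
  open import Data.List.Relation.Binary.Subset.Propositional using () renaming (_⊆_ to _⊑_)
  open import Data.Product using (Σ; _,_; proj₁; proj₂)
  open import Data.Sum using (_⊎_; inj₁; inj₂)
  open import Relation.Nullary using (yes; no)
  open import Relation.Binary.PropositionalEquality using (_≡_; refl; cong)
  open import Relation.Binary.Construct.Closure.ReflexiveTransitive using (ε; _◅_)
  open Connectivity {n}

  private
    variable
      A : List (Edge n)
      a b u v : Fin n

  vertices : Connected A u v → List (Fin n)
  vertices {u = u} ε       = [ u ]
  vertices {u = u} (_ ◅ p) = u ∷ vertices p

  start∈vertices : (p : Connected A u v) → u ∈ vertices p
  start∈vertices ε       = here refl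
  start∈vertices (_ ◅ _) = here refl

  orient : Adjacent A a b → Edge n
  orient {a = a} {b} (inj₁ _) = a , b
  orient {a = a} {b} (inj₂ _) = b , a

  orient∈ : (adj : Adjacent A a b) → orient adj ∈ A
  orient∈ (inj₁ ab∈A) = ab∈A
  orient∈ (inj₂ ba∈A) = ba∈A

  orient-adjacent : (adj : Adjacent A a b) → ∀ {B} → Adjacent (orient adj ∷ B) a b
  orient-adjacent (inj₁ _) = inj₁ (here refl)
  orient-adjacent (inj₂ _) = inj₂ (here refl)

  rk-orient-∷ : ∀ {B} (adj : Adjacent A a b) → Connected B a b → rk (orient adj ∷ B) ≡ rk B
  rk-orient-∷ (inj₁ _) a~b = rk-∷-connected a~b
  rk-orient-∷ (inj₂ _) a~b = rk-∷-connected (connected-sym a~b)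

  Endpoint : Fin n → Edge n → Set
  Endpoint z e = proj₁ e ≡ z ⊎ proj₂ e ≡ z

  orient-endpoints : (adj : Adjacent A a b) → ∀ {z} → Endpoint z (orient adj) → z ≡ a ⊎ z ≡ b
  orient-endpoints (inj₁ _) (inj₁ refl) = inj₁ refl
  orient-endpoints (inj₁ _) (inj₂ refl) = inj₂ refl
  orient-endpoints (inj₂ _) (inj₁ refl) = inj₂ refl
  orient-endpoints (inj₂ _) (inj₂ refl) = inj₁ refl

  orient-start : (adj : Adjacent A a b) → Endpoint a (orient adj)
  orient-start (inj₁ _) = inj₁ refl
  orient-start (inj₂ _) = inj₂ refl

  orient-end : (adj : Adjacent A a b) → Endpoint b (orient adj)
  orient-end (inj₁ _) = inj₂ refl
  orient-end (inj₂ _) = inj₁ refl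

  path-edges : Connected A u v → List (Edge n)
  path-edges ε         = []
  path-edges (adj ◅ p) = orient adj ∷ path-edges p

  path-edges⊑ : (p : Connected A u v) → path-edges p ⊑ A
  path-edges⊑ (adj ◅ p) (here refl) = orient∈ adj
  path-edges⊑ (adj ◅ p) (there e∈p) = path-edges⊑ p e∈p

  length-vertices : (p : Connected A u v) → length (vertices p) ≡ suc (length (path-edges p))
  length-vertices ε       = refl
  length-vertices (_ ◅ p) = cong suc (length-vertices p)

  endpoint∈vertices : (p : Connected A u v) → ∀ {e z} → e ∈ path-edges p → Endpoint z e → z ∈ vertices p
  endpoint∈vertices (adj ◅ p) (here refl) z∈e with orient-endpoints adj z∈e
  ... | inj₁ refl = here refl
  ... | inj₂ refl = there (start∈vertices p)
  endpoint∈vertices (_ ◅ p) (there e∈p) z∈e = there (endpoint∈vertices p e∈p z∈e)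

  path-edges-unique : (p : Connected A u v) → Unique (vertices p) → Unique (path-edges p)
  path-edges-unique ε         _            = []
  path-edges-unique (adj ◅ p) (u∉p ∷ uniq) =
    ¬Any⇒All¬ _ (λ e∈p → All¬⇒¬Any u∉p (endpoint∈vertices p e∈p (orient-start adj))) ∷ path-edges-unique p uniq

  suffix : (q : Connected A v b) → u ∈ vertices q →
           Σ (Connected A u b) λ q′ → Unique (vertices q) → Unique (vertices q′)
  suffix ε         (here refl) = ε , λ uniq → uniq
  suffix (adj ◅ q) (here refl) = adj ◅ q , λ uniq → uniq
  suffix (_ ◅ q)   (there u∈q) with suffix q u∈q
  ... | q′ , uniq′ = q′ , λ { (_ ∷ uniq) → uniq′ uniq }

  simple-path : Connected A u v → Σ (Connected A u v) λ p → Unique (vertices p)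
  simple-path ε = ε , [] ∷ []
  simple-path {u = u} (adj ◅ p) with simple-path p
  ... | q , uniq with any? (u ≟ᶠ_) (vertices q)
  ... | yes u∈q = proj₁ (suffix q u∈q) , proj₂ (suffix q u∈q) uniq
  ... | no  u∉q = adj ◅ q , ¬Any⇒All¬ _ u∉q ∷ uniq

module Cycles {n : ℕ} (G : Graph n) where

  open import Data.Nat using (suc; _≤_; _<_; z≤n; s≤s)
  open import Data.Nat.Properties using (<-irrefl; <-asym; m≤n⇒m≤1+n; +-comm; module ≤-Reasoning)
  open import Data.Fin using (Fin; toℕ) renaming (_≟_ to _≟ᶠ_)
  open import Data.List using (List; []; _∷_; [_]; _++_; length; filter)
  open import Data.List.Properties using (length-++)
  open import Data.List.Membership.Propositional using (_∈_)
  open import Data.List.Membership.Propositional.Properties using (∈-filter⁺; ∈-filter⁻)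
  open import Data.List.Relation.Unary.Any using (here; there)
  open import Data.List.Relation.Unary.All as All using (All; []; _∷_)
  open import Data.List.Relation.Unary.All.Properties using (¬Any⇒All¬; All¬⇒¬Any)
  open import Data.List.Relation.Unary.Unique.Propositional using (Unique)
  open import Data.List.Relation.Unary.Unique.Propositional.Properties using (filter⁺)
  open import Data.List.Relation.Unary.AllPairs using (_∷_)
  open import Data.List.Relation.Unary.Linked using (Linked; []; [-]; _∷_)
  open import Data.List.Relation.Binary.Subset.Propositional using () renaming (_⊆_ to _⊑_)
  open import Data.List.Relation.Binary.Sublist.Propositional using (_⊆_; lookup)
  open import Data.List.Relation.Binary.Sublist.Propositional.Properties using (All-resp-⊆; filter-⊆)
  open import Data.Product using (∃-syntax; _×_; _,_; proj₁; proj₂; map₂)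
  open import Data.Product.Properties using (≡-dec)
  open import Data.Sum using (inj₁; inj₂)
  import Data.Sum as Sum
  open import Data.Empty using (⊥-elim)
  open import Function using (_∘_)
  open import Relation.Nullary using (¬_; Dec; yes; no)
  open import Relation.Binary.PropositionalEquality using (_≡_; refl; sym; trans; cong; subst)
  open import Relation.Binary.Construct.Closure.ReflexiveTransitive using (ε; _◅_)
  open Connectivity {n}
  open Forests {n}
  open Paths {n}
  open Matroids {Edge n} using (IndependentUpTo)
  open ListFacts

  private
    variable
      A : List (Edge n)
      a b u v w : Fin n

  _≟ₑ_ : (x y : Edge n) → Dec (x ≡ y)
  _≟ₑ_ = ≡-dec _≟ᶠ_ _≟ᶠ_

  open import Data.List.Membership.DecPropositional _≟ₑ_ using (_∈?_)

  Ordered : Edge n → Set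
  Ordered e = toℕ (proj₁ e) < toℕ (proj₂ e)

  cycle-linked : A ⊑ edges G → (p : Connected A u v) → Adj G v w → Linked (Adj G) (vertices p ++ [ w ])
  cycle-linked A⊑E ε                v~w = v~w ∷ [-]
  cycle-linked A⊑E (adj ◅ ε)        v~w = Sum.map A⊑E A⊑E adj ∷ v~w ∷ [-]
  cycle-linked A⊑E (adj ◅ adj′ ◅ p) v~w = Sum.map A⊑E A⊑E adj ∷ cycle-linked A⊑E (adj′ ◅ p) v~w

  close-cycle : All Ordered A → A ⊑ edges G → (u , w) ∈ edges G → Ordered (u , w) → ¬ (u , w) ∈ A →
    (p : Connected A u w) → Unique (vertices p) → ∃[ c ] IsCycle G c × length c ≤ suc (length A)
  close-cycle oA A⊑E uw∈E u<w uw∉A ε                  _    = ⊥-elim (<-irrefl refl u<w)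
  close-cycle oA A⊑E uw∈E u<w uw∉A (inj₁ uw∈A ◅ ε)    _    = ⊥-elim (uw∉A uw∈A)
  close-cycle oA A⊑E uw∈E u<w uw∉A (inj₂ wu∈A ◅ ε)    _    = ⊥-elim (<-asym u<w (All.lookup oA wu∈A))
  close-cycle {A} oA A⊑E uw∈E u<w uw∉A p@(_ ◅ _ ◅ q) uniq =
    vertices p , (three≤ , uniq , cycle-linked A⊑E p (inj₂ uw∈E)) , length-bound
    where
    three≤ : 3 ≤ length (vertices p)
    three≤ rewrite length-vertices q = s≤s (s≤s (s≤s z≤n))
    length-bound : length (vertices p) ≤ suc (length A)
    length-bound rewrite length-vertices p =
      s≤s (length-≤-Unique (path-edges-unique p uniq) (path-edges⊑ p))

  dependent⇒cycle : A ⊆ edges G → ¬ Forest A → ∃[ c ] IsCycle G c × length c ≤ length A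
  dependent⇒cycle A⊆E = go (Unique-⊆ A⊆E (distinct G)) (All-resp-⊆ A⊆E (ordered G)) (lookup A⊆E)
    where
    go : ∀ {A} → Unique A → All Ordered A → A ⊑ edges G → ¬ Forest A → ∃[ c ] IsCycle G c × length c ≤ length A
    go {[]}          _            _            _   ¬f = ⊥-elim (¬f z≤n)
    go {(u , w) ∷ A} (uw∉A ∷ uA) (u<w ∷ oA) A⊑E ¬f with forest? A
    ... | no ¬fA = map₂ (map₂ m≤n⇒m≤1+n) (go uA oA (A⊑E ∘ there) ¬fA)
    ... | yes fA with connected? A u w
    ... | no ¬u~w = ⊥-elim (¬f (forest-∷⁺ fA ¬u~w))
    ... | yes u~w with simple-path u~w
    ... | p , uniq = close-cycle oA (A⊑E ∘ there) (A⊑E (here refl)) u<w (All¬⇒¬Any uw∉A) p uniq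

  girth⇒independentUpTo : ∀ {g k} → (∀ c → IsCycle G c → g ≤ length c) → k < g →
                          IndependentUpTo Forest (edges G) k
  girth⇒independentUpTo {g} {k} shortest k<g {A} A⊆E A≤k with forest? A
  ... | yes fA = fA
  ... | no ¬fA with dependent⇒cycle A⊆E ¬fA
  ... | c , cyc , c≤A = ⊥-elim (<-irrefl refl (begin-strict
    g         ≤⟨ shortest c cyc ⟩
    length c  ≤⟨ c≤A ⟩
    length A  ≤⟨ A≤k ⟩
    k         <⟨ k<g ⟩
    g         ∎))
    where open ≤-Reasoning

  chain-edges : ∀ {xs} → Linked (Adj G) xs → List (Edge n)
  chain-edges []        = []
  chain-edges [-]       = []
  chain-edges (adj ∷ l) = orient adj ∷ chain-edges l

  chain-edges⊑ : ∀ {xs} (l : Linked (Adj G) xs) → chain-edges l ⊑ edges G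
  chain-edges⊑ (adj ∷ l) (here refl) = orient∈ adj
  chain-edges⊑ (adj ∷ l) (there e∈l) = chain-edges⊑ l e∈l

  length-chain-edges : ∀ {x xs} (l : Linked (Adj G) (x ∷ xs)) → length (chain-edges l) ≡ length xs
  length-chain-edges [-]     = refl
  length-chain-edges (_ ∷ l) = cong suc (length-chain-edges l)

  chain-connected : ∀ {x y} ys (l : Linked (Adj G) (x ∷ ys ++ [ y ])) → Connected (chain-edges l) x y
  chain-connected []       (adj ∷ [-]) = orient-adjacent adj ◅ ε
  chain-connected (_ ∷ ys) (adj ∷ l)   = orient-adjacent adj ◅ connected-mono there (chain-connected ys l)

  chain-left-endpoint : ∀ {y e} ys (l : Linked (Adj G) (ys ++ [ y ])) → e ∈ chain-edges l →
                        ∃[ z ] z ∈ ys × Endpoint z e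
  chain-left-endpoint []            [-]         ()
  chain-left-endpoint (x ∷ [])      (adj ∷ [-]) (here refl) = x , here refl , orient-start adj
  chain-left-endpoint (x ∷ [])      (adj ∷ [-]) (there ())
  chain-left-endpoint (x ∷ _ ∷ ys)  (adj ∷ l)   (here refl) = x , here refl , orient-start adj
  chain-left-endpoint (x ∷ x′ ∷ ys) (adj ∷ l)   (there e∈l) with chain-left-endpoint (x′ ∷ ys) l e∈l
  ... | z , z∈ys , z∈e = z , there z∈ys , z∈e

  redundant-edge⇒dependent : ∀ {B D D′} (adj : Adjacent B a b) → Connected D′ a b → Unique (orient adj ∷ D′) →
    D ⊑ orient adj ∷ D′ → orient adj ∷ D′ ⊑ D → ¬ Forest D
  redundant-edge⇒dependent {D = D} {D′} adj a~b unique D⊑ ⊑D D≤rk = <-irrefl refl (begin-strict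
    length D              ≤⟨ D≤rk ⟩
    rk D                  ≤⟨ rk-mono (connected-mono D⊑) ⟩
    rk (orient adj ∷ D′)  ≡⟨ rk-orient-∷ adj a~b ⟩
    rk D′                 ≤⟨ rk≤length D′ ⟩
    length D′             <⟨ length-≤-Unique unique ⊑D ⟩
    length D              ∎)
    where open ≤-Reasoning

  -- D collects the edges of the cycle.  Its edge e₀ between v and v₁ is redundant: the other
  -- edges C′ connect v₁ back to v, and e₀ ∉ C′ since each edge of C′ has an endpoint in w ∷ ws.
  cycle⇒dependent : ∀ {c} → IsCycle G c → ∃[ D ] D ⊆ edges G × ¬ Forest D × length D ≤ length c
  cycle⇒dependent {_ ∷ []}     (s≤s () , _)
  cycle⇒dependent {_ ∷ _ ∷ []} (s≤s (s≤s ()) , _)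
  cycle⇒dependent {v ∷ v₁ ∷ w ∷ ws} (_ , (v∉ ∷ v₁∉ ∷ _) , adj ∷ l@(adj₁ ∷ l₁)) =
    D , filter-⊆ (_∈? C) (edges G) , ¬forest , length-bound
    where
    e₀ = orient adj
    C′ = chain-edges l
    C  = e₀ ∷ C′
    D  = filter (_∈? C) (edges G)
    D′ = filter (_∈? C′) (edges G)

    distinct-from-v-v₁ : ∀ {z} → z ∈ w ∷ ws → ¬ Endpoint z e₀
    distinct-from-v-v₁ z∈ z∈e₀ with orient-endpoints adj z∈e₀
    ... | inj₁ refl = All¬⇒¬Any (All.tail v∉) z∈
    ... | inj₂ refl = All¬⇒¬Any v₁∉ z∈

    e₀∉C′ : ¬ e₀ ∈ C′
    e₀∉C′ (here e₀≡) = distinct-from-v-v₁ (here refl) (subst (Endpoint w) (sym e₀≡) (orient-end adj₁))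
    e₀∉C′ (there e₀∈) with chain-left-endpoint (w ∷ ws) l₁ e₀∈
    ... | z , z∈ , z∈e₀ = distinct-from-v-v₁ z∈ z∈e₀

    D⊑C : D ⊑ C
    D⊑C = proj₂ ∘ ∈-filter⁻ (_∈? C) {xs = edges G}

    C′⊑D′ : C′ ⊑ D′
    C′⊑D′ e∈C′ = ∈-filter⁺ (_∈? C′) (chain-edges⊑ l e∈C′) e∈C′

    D⊑e₀∷D′ : D ⊑ e₀ ∷ D′
    D⊑e₀∷D′ e∈D with D⊑C e∈D
    ... | here refl  = here refl
    ... | there e∈C′ = there (C′⊑D′ e∈C′)

    e₀∷D′⊑D : e₀ ∷ D′ ⊑ D
    e₀∷D′⊑D (here refl)  = ∈-filter⁺ (_∈? C) (orient∈ adj) (here refl)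
    e₀∷D′⊑D (there e∈D′) with ∈-filter⁻ (_∈? C′) {xs = edges G} e∈D′
    ... | e∈E , e∈C′ = ∈-filter⁺ (_∈? C) e∈E (there e∈C′)

    unique-e₀∷D′ : Unique (e₀ ∷ D′)
    unique-e₀∷D′ =
      ¬Any⇒All¬ D′ (e₀∉C′ ∘ proj₂ ∘ ∈-filter⁻ (_∈? C′) {xs = edges G}) ∷ filter⁺ (_∈? C′) (distinct G)

    ¬forest : ¬ Forest D
    ¬forest = redundant-edge⇒dependent adj (connected-sym (connected-mono C′⊑D′ (chain-connected (w ∷ ws) l)))
                unique-e₀∷D′ D⊑e₀∷D′ e₀∷D′⊑D

    length-bound : length D ≤ length (v ∷ v₁ ∷ w ∷ ws)
    length-bound = begin
      length D                          ≤⟨ length-≤-Unique (filter⁺ (_∈? C) (distinct G)) D⊑C ⟩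
      length C                          ≡⟨ length-chain-edges (adj ∷ l) ⟩
      suc (suc (length (ws ++ [ v ])))  ≡⟨ cong (suc ∘ suc) (trans (length-++ ws) (+-comm (length ws) 1)) ⟩
      length (v ∷ v₁ ∷ w ∷ ws)          ∎
      where open ≤-Reasoning

module TutteCoefficients {n : ℕ} (G : Graph n) where

  open import Data.Nat using (_∸_)
  open import Data.Integer using (+_; _-_; _<_)
  open import Relation.Binary.PropositionalEquality using (_≡_)
  open import Function.Bundles using (_⇔_)
  open import Data.Nat as ℕ using (zero; suc; _≤_; _<?_)
  import Data.Nat.Properties as ℕₚ
  open import Data.Integer as ℤ using (0ℤ; 1ℤ; _⊖_; _*_; +<+)
  import Data.Integer.Properties as ℤₚ
  open import Data.Nat.Combinatorics using (_C_)
  open import Data.List using (length)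
  open import Data.Product using (_,_)
  open import Data.Empty using (⊥-elim)
  open import Relation.Nullary using (yes; no)
  open import Relation.Binary.PropositionalEquality using (refl; sym; trans; cong; cong₂; module ≡-Reasoning)
  open import Function.Bundles using (mk⇔)
  open Polynomials
  open Subsets
  open UniformCoefficients
  open Matroids
  open Connectivity {n}
  open Forests {n}
  open Cycles G

  E = edges G
  r = rk E

  summand-coeff : ∀ i A →
    coeff i (atY1 (xy (pow X-1 (r ∸ rk A)) (pow X-1 (length A ∸ rk A)))) ≡ indTerm forest? r i A
  summand-coeff i A with forest? A
  ... | yes fA = begin
    coeff i (atY1 (xy (pow X-1 (r ∸ rk A)) (pow X-1 (length A ∸ rk A))))
      ≡⟨ coeff-atY1-xy i (pow X-1 (r ∸ rk A)) (pow X-1 (length A ∸ rk A)) ⟩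
    coeff i (pow X-1 (r ∸ rk A)) * sumℤ (pow X-1 (length A ∸ rk A))
      ≡⟨ cong₂ (λ a b → coeff i (pow X-1 (r ∸ a)) * sumℤ (pow X-1 b))
               (ℕₚ.≤-antisym (rk≤length A) fA) (ℕₚ.m≤n⇒m∸n≡0 fA) ⟩
    coeff i (pow X-1 (r ∸ length A)) * 1ℤ
      ≡⟨ ℤₚ.*-identityʳ (coeff i (pow X-1 (r ∸ length A))) ⟩
    coeff i (pow X-1 (r ∸ length A))
      ≡⟨ indTerm-ind forest? {r} {i} {A} fA ⟨
    indTerm forest? r i A ∎
    where open ≡-Reasoning
  ... | no ¬fA = trans (coeff-atY1-xy i (pow X-1 (r ∸ rk A)) (pow X-1 (length A ∸ rk A)))
                       (trans (positive-nullity (length A ∸ rk A) refl)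
                              (sym (indTerm-dep forest? {r} {i} {A} ¬fA)))
    where
    positive-nullity : ∀ d → length A ∸ rk A ≡ d → coeff i (pow X-1 (r ∸ rk A)) * sumℤ (pow X-1 d) ≡ 0ℤ
    positive-nullity zero    eq = ⊥-elim (¬fA (ℕₚ.m∸n≡0⇒m≤n eq))
    positive-nullity (suc d) _  = trans (cong (coeff i (pow X-1 (r ∸ rk A)) *_) (sum-pow-X-1 d))
                                        (ℤₚ.*-zeroʳ (coeff i (pow X-1 (r ∸ rk A))))

  coeff-tutte : ∀ i → coeff i (atY1 (tutte G)) ≡ coeffSum forest? r i E
  coeff-tutte i =
    trans (coeff-atY1-sum i _ (subsets E)) (sum-cong-All (subsets-⊆ E) (λ {A} _ → summand-coeff i A))

  forest-bound : ∀ {i} → i ≤ r → CoeffSumBounded forest? E r i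
  forest-bound = coeffSum-bound E forest? (forest-matroid (distinct G)) (forest-rank E)

  rank<#edges : HasCycle G → r ℕ.< #edges G
  rank<#edges (c , cyc) with cycle⇒dependent cyc
  ... | D , D⊆E , ¬fD , _ = ℕₚ.≰⇒> λ E≤r → ¬fD (forest-⊆ D⊆E (ind-whole (forest-rank E) E≤r))

  girth-criterion : HasCycle G → ∀ {g} → IsGirth G g → ∀ {i} → i ≤ r →
    (+ (r ∸ i) < + g) ⇔ (coeff i (atY1 (tutte G)) ≡ + ((#edges G ∸ i ∸ 1) C (r ∸ i)))
  girth-criterion hasCycle {g} ((c , cyc , c≡g) , shortest) {i} i≤r = mk⇔
    (λ { (+<+ k<g) → trans (coeff-tutte i) (trans (sharp B (girth⇒independentUpTo shortest k<g)) U≡) })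
    short-enough
    where
    open SharpBound
    B = forest-bound i≤r
    U≡ : + uniformCoeff (#edges G ∸ r) (r ∸ i) ≡ + ((#edges G ∸ i ∸ 1) C (r ∸ i))
    U≡ = cong +_ (uniformCoeff-corank (rank<#edges hasCycle) i≤r)
    short-enough : coeff i (atY1 (tutte G)) ≡ + ((#edges G ∸ i ∸ 1) C (r ∸ i)) → + (r ∸ i) < + g
    short-enough eq with r ∸ i <? g
    ... | yes k<g = +<+ k<g
    ... | no  k≮g with cycle⇒dependent cyc
    ... | D , D⊆E , ¬fD , D≤c = ⊥-elim (ℤₚ.<-irrefl (trans (sym (coeff-tutte i)) (trans eq (sym U≡)))
          (strict B (D , D⊆E , ℕₚ.≤-trans D≤c (ℕₚ.≤-trans (ℕₚ.≤-reflexive c≡g) (ℕₚ.≮⇒≥ k≮g)) , ¬fD)))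

  excess≡rank⊖ : ∀ i → + n - + k G - + i ≡ r ⊖ i
  excess≡rank⊖ i = trans (cong (_- + i) (trans (ℤₚ.m-n≡m⊖n n (k G)) (ℤₚ.⊖-≥ (components≤n E)))) (ℤₚ.m-n≡m⊖n r i)

  coeff-above-rank : ∀ {i} → r ℕ.< i → coeff i (atY1 (tutte G)) ≡ 0ℤ
  coeff-above-rank {i} r<i = trans (coeff-tutte i) (coeffSum-> forest? r<i E)

open import Data.Nat using (ℕ; _∸_)
open import Data.Integer using (+_; _-_; _<_)
open import Relation.Binary.PropositionalEquality using (_≡_)
open import Function.Bundles using (_⇔_)
import Data.Nat as ℕ
open import Data.Nat.Properties using (_≤?_; ≰⇒>; +-∸-assoc)
open import Data.Integer using (-_; _⊖_; -[1+_]; -<+)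
open import Data.Integer.Properties using (⊖-≥; ⊖-<)
open import Relation.Nullary using (yes; no)
open import Relation.Binary.PropositionalEquality using (trans; cong)
open import Function.Bundles using (mk⇔)
open TutteCoefficients

⊖-negsuc : ∀ {m n} → m ℕ.< n → m ⊖ n ≡ -[1+ n ∸ ℕ.suc m ]
⊖-negsuc m<n = trans (⊖-< m<n) (cong (λ d → - (+ d)) (+-∸-assoc 1 m<n))

corollary3p8 : ∀ {n : ℕ} (G : Graph n) → HasCycle G →
    (i g : ℕ) → IsGirth G g →
    ((+ n - + k G - + i) < + g)
      ⇔ (coeff i (atY1 (tutte G)) ≡ binomℤ (#edges G ∸ i ∸ 1) (+ n - + k G - + i))
corollary3p8 G hasCycle i g girth rewrite excess≡rank⊖ G i with i ≤? r G
... | yes i≤r rewrite ⊖-≥ i≤r         = girth-criterion G hasCycle girth i≤r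
... | no  i≰r rewrite ⊖-negsuc (≰⇒> i≰r) = mk⇔ (λ _ → coeff-above-rank G (≰⇒> i≰r)) (λ _ → -<+)
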